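{- Let $\ell\ge7$ and let $F$ be an apexed $\ell$-frame. Then every two holes in $F$ are equivalent.
   Context: A hole is an induced cycle of length at least four; lengths count edges. Two holes $C,C'$ are close if $|V(C\cap C')|\ge4$, and equivalent if there is a sequence of holes $C=C_1,\dots,C_n=C'$ with $C_i,C_{i+1}$ close for $1\le i<n$. A threshold graph is a graph with no induced four-vertex path, four-vertex cycle or two-edge matching. $\ell$-frame for $\ell$ odd: $k\ge3$; distinct vertices $a_1,\dots,a_k,b_1,\dots,b_k$; pairwise vertex-disjoint paths $P_i$ of length $(\ell-3)/2$ with ends $a_i,b_i$; threshold graphs $A$ on $\{a_i\}$ and $B$ on $\{b_i\}$ with $b_ib_j\in E$ iff $a_ia_j\notin E$ ($i<j$), each of $A,B$ disconnected or two-connected; $F$ is the union of $A,B,P_1,\dots,P_k$. Exactly one of $A,B$ is disconnected, and the apexed frame adds one new vertex adjacent exactly to the vertices of that one. $\ell$-frame for $\ell$ even: $m\ge0$, $n\ge2$, $m+n\ge3$; distinct $a_1,\dots,a_n,c_1,\dots,c_m,b_1,\dots,b_n,d_1,\dots,d_m$; pairwise vertex-disjoint paths $P_i$ ($i\le n$) of length $\ell/2-2$ with ends $a_i,b_i$ and $Q_i$ ($i\le m$) of length $\ell/2-1$ with ends $c_i,d_i$; graphs $A$ on $\{a_i\}\cup\{c_j\}$ and $B$ on $\{b_i\}\cup\{d_j\}$ with $\{c_j\},\{d_j\}$ cliques, $\{a_i\},\{b_i\}$ stable, the bipartite graph between $\{a_i\}$ and $\{c_j\}$ a half-graph (no induced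 two-edge matching), $b_id_j\in E$ iff $a_ic_j\notin E$, some $a_i$ of degree $0$ in $A$ and some $b_i$ of degree $0$ in $B$; $F$ the union of $A,B$ and all paths. The apexed frame adds new vertices $a_0$ adjacent exactly to $V(A)$ and $b_0$ adjacent exactly to $V(B)$. -}

module Defs where

open import Data.Nat using (ℕ; zero; suc; _+_; _∸_; _≤_; _/_; _%_)
open import Data.Fin using (Fin; toℕ; _≟_)
open import Data.Bool using (Bool; true; false; not; if_then_else_)
open import Data.Product using (Σ; ∃; _×_; _,_)
open import Data.Sum using (_⊎_; inj₁; inj₂)
open import Data.Unit using (⊤; tt)
open import Data.Empty using (⊥)
open import Relation.Nullary using (¬_; yes; no)
open import Relation.Binary.PropositionalEquality using (_≡_; _≢_)
open import Relation.Binary.Construct.Closure.ReflexiveTransitive using (Star)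
open import Function.Definitions using (Injective)

record Graph : Set₁ where
  field
    V   : Set
    _~_ : V → V → Set

CycSucc : (k : ℕ) → Fin k → Fin k → Set
CycSucc k x y = (suc (toℕ x) ≡ toℕ y) ⊎ (suc (toℕ x) ≡ k × toℕ y ≡ 0)

CycAdj : (k : ℕ) → Fin k → Fin k → Set
CycAdj k i j = CycSucc k i j ⊎ CycSucc k j i

-- A hole: an induced cycle of length (= number of edges = number of
-- vertices) at least 4, given by a cyclic sequence of distinct vertices.
record Hole (G : Graph) : Set where
  open Graph G
  field
    len     : ℕ
    len≥4   : 4 ≤ len
    vtx     : Fin len → V
    vtx-inj : Injective _≡_ _≡_ vtx
    induced : ∀ i j → (vtx i ~ vtx j → CycAdj len i j) × (CycAdj len i j → vtx i ~ vtx j)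

_∈H_ : {G : Graph} → Graph.V G → Hole G → Set
_∈H_ x C = ∃ λ i → Hole.vtx C i ≡ x

-- close: |V(C ∩ C')| ≥ 4, i.e. four distinct common vertices
Close : {G : Graph} → Hole G → Hole G → Set
Close {G} C C' = Σ (Fin 4 → Graph.V G) λ f →
  Injective _≡_ _≡_ f × (∀ p → (f p ∈H C) × (f p ∈H C'))

Equivalent : {G : Graph} → Hole G → Hole G → Set
Equivalent {G} = Star (Close {G})

AllHolesEquivalent : Graph → Set
AllHolesEquivalent G = (C C' : Hole G) → Equivalent C C'

BGraph : ℕ → Set
BGraph k = Fin k → Fin k → Bool

IsSimple : {k : ℕ} → BGraph k → Set
IsSimple A = (∀ i j → A i j ≡ A j i) × (∀ i → A i i ≡ false)

Compl : {k : ℕ} → BGraph k → BGraph k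
Compl A i j with i ≟ j
... | yes _ = false
... | no  _ = not (A i j)

module _ {k : ℕ} (A : BGraph k) where
  E N : Fin k → Fin k → Set
  E i j = A i j ≡ true
  N i j = A i j ≡ false

  Distinct4 : Fin k → Fin k → Fin k → Fin k → Set
  Distinct4 a b c d = a ≢ b × a ≢ c × a ≢ d × b ≢ c × b ≢ d × c ≢ d

  InducedP4 InducedC4 Induced2K2 : Fin k → Fin k → Fin k → Fin k → Set
  InducedP4 a b c d = E a b × E b c × E c d × N a c × N b d × N a d
  InducedC4 a b c d = E a b × E b c × E c d × E d a × N a c × N b d
  Induced2K2 a b c d = E a b × E c d × N a c × N a d × N b c × N b d

  Threshold : Set
  Threshold = ∀ a b c d → Distinct4 a b c d →
    ¬ InducedP4 a b c d × ¬ InducedC4 a b c d × ¬ Induced2K2 a b c d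

  Connected : Set
  Connected = ∀ u v → Star E u v

  Disconnected : Set
  Disconnected = ¬ Connected

  TwoConnected : Set
  TwoConnected = 3 ≤ k × (∀ x u v → u ≢ x → v ≢ x →
    Star (λ p q → p ≢ x × q ≢ x × E p q) u v)

oddLen : ℕ → ℕ
oddLen ℓ = (ℓ ∸ 3) / 2

record OddFrame (ℓ : ℕ) : Set where
  field
    k        : ℕ
    k≥3      : 3 ≤ k
    A        : BGraph k
    A-simple : IsSimple A
    A-thr    : Threshold A
    B-thr    : Threshold (Compl A)
    A-dc     : Disconnected A ⊎ TwoConnected A
    B-dc     : Disconnected (Compl A) ⊎ TwoConnected (Compl A)
    -- true: A is the disconnected one (apex attaches to A); false: B
    apexOnA  : Bool
    exactlyOne : if apexOnA
                 then (Disconnected A × ¬ Disconnected (Compl A))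
                 else (Disconnected (Compl A) × ¬ Disconnected A)

-- vertex (i , p): p-th vertex of path P_i (p = 0 is a_i, p = oddLen ℓ is b_i);
-- inj₂ tt is the apex
OddV : {ℓ : ℕ} → OddFrame ℓ → Set
OddV {ℓ} F = (Fin (OddFrame.k F) × Fin (suc (oddLen ℓ))) ⊎ ⊤

oddR : {ℓ : ℕ} (F : OddFrame ℓ) → OddV F → OddV F → Set
oddR {ℓ} F (inj₁ (i , p)) (inj₁ (j , q)) =
    (i ≡ j × suc (toℕ p) ≡ toℕ q)
  ⊎ (toℕ p ≡ 0 × toℕ q ≡ 0 × OddFrame.A F i j ≡ true)
  ⊎ (toℕ p ≡ oddLen ℓ × toℕ q ≡ oddLen ℓ × Compl (OddFrame.A F) i j ≡ true)
oddR {ℓ} F (inj₁ (i , p)) (inj₂ tt) =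
  if OddFrame.apexOnA F then toℕ p ≡ 0 else toℕ p ≡ oddLen ℓ
oddR F (inj₂ tt) _ = ⊥

oddApexedGraph : {ℓ : ℕ} → OddFrame ℓ → Graph
oddApexedGraph F = record
  { V = OddV F
  ; _~_ = λ x y → oddR F x y ⊎ oddR F y x }

evenLenP evenLenQ : ℕ → ℕ
evenLenP ℓ = ℓ / 2 ∸ 2
evenLenQ ℓ = ℓ / 2 ∸ 1

record EvenFrame (ℓ : ℕ) : Set where
  field
    n m   : ℕ
    n≥2   : 2 ≤ n
    nm≥3  : 3 ≤ n + m
    -- H i j = true  iff  a_i c_j is an edge (equivalently b_i d_j is not)
    H     : Fin n → Fin m → Bool
    half  : ∀ i i' j j' → ¬ (H i j ≡ true × H i' j' ≡ true × H i j' ≡ false × H i' j ≡ false)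
    a-deg0 : ∃ λ i → ∀ j → H i j ≡ false
    b-deg0 : ∃ λ i → ∀ j → H i j ≡ true

-- pv i p : p-th vertex of P_i (p = 0 is a_i, p = evenLenP ℓ is b_i)
-- qv j q : q-th vertex of Q_j (q = 0 is c_j, q = evenLenQ ℓ is d_j)
data EvenV (n m LP LQ : ℕ) : Set where
  pv : Fin n → Fin (suc LP) → EvenV n m LP LQ
  qv : Fin m → Fin (suc LQ) → EvenV n m LP LQ
  a0 b0 : EvenV n m LP LQ

EvenFV : {ℓ : ℕ} → EvenFrame ℓ → Set
EvenFV {ℓ} F = EvenV (EvenFrame.n F) (EvenFrame.m F) (evenLenP ℓ) (evenLenQ ℓ)

evenR : {ℓ : ℕ} (F : EvenFrame ℓ) → EvenFV F → EvenFV F → Set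
evenR F (pv i p) (pv j q) = i ≡ j × suc (toℕ p) ≡ toℕ q
evenR {ℓ} F (qv i p) (qv j q) =
    (i ≡ j × suc (toℕ p) ≡ toℕ q)
  ⊎ (i ≢ j × toℕ p ≡ 0 × toℕ q ≡ 0)
  ⊎ (i ≢ j × toℕ p ≡ evenLenQ ℓ × toℕ q ≡ evenLenQ ℓ)
evenR {ℓ} F (pv i p) (qv j q) =
    (toℕ p ≡ 0 × toℕ q ≡ 0 × EvenFrame.H F i j ≡ true)
  ⊎ (toℕ p ≡ evenLenP ℓ × toℕ q ≡ evenLenQ ℓ × EvenFrame.H F i j ≡ false)
evenR F a0 (pv i p) = toℕ p ≡ 0
evenR F a0 (qv j q) = toℕ q ≡ 0
evenR {ℓ} F b0 (pv i p) = toℕ p ≡ evenLenP ℓ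
evenR {ℓ} F b0 (qv j q) = toℕ q ≡ evenLenQ ℓ
evenR F _ _ = ⊥

evenApexedGraph : {ℓ : ℕ} → EvenFrame ℓ → Graph
evenApexedGraph F = record
  { V = EvenFV F
  ; _~_ = λ x y → evenR F x y ⊎ evenR F y x }

-- An apexed frame is a ladder: induced paths (rungs) whose
-- bottom ends, and whose top ends, are joined by a graph without induced P4
-- or C4, together with apex vertices. Levels increase along every rung and
-- are constant on every other edge, so a hole of non-constant level crosses
-- some cut between consecutive levels at least twice, never twice along the
-- same rung edge; it therefore contains an edge of two different rungs and is
-- close to the canonical hole running up one of them and down the other
-- (closed at each end by an edge, an apex, or an end vertex of a third rung).
-- A hole of constant level would live among the ends of one side and an apex
-- adjacent to all of them, which is impossible without induced P4 and C4.
-- Since ℓ ≥ 7 every rung has at least three vertices, and canonical holes are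
-- chained to a fixed one through holes sharing the first three vertices of a
-- rung and one more vertex.
module Submission where

open import Defs
open import Data.Nat using (ℕ; zero; suc; _+_; _∸_; _≤_; _<_; z≤n; s≤s; s≤s⁻¹; _≤ᵇ_; _≤?_; _<?_; NonZero; >-nonZero; _/_; _%_)
open import Data.Nat.Properties hiding (_≟_)
open import Data.Nat.DivMod using (m%n<n; m<n⇒m%n≡m; n%n≡0; /-monoˡ-≤)
open import Data.Fin using (Fin; toℕ; fromℕ<; _≟_) renaming (zero to fz; suc to fs)
open import Data.Fin.Properties using (toℕ-fromℕ<; toℕ-injective; toℕ<n; all?; any?; ¬∀⟶∃¬)
open import Data.Bool using (Bool; true; false; T; not; if_then_else_)
open import Data.Maybe using (Maybe; just; nothing)
open import Data.Maybe.Properties using (just-injective)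
open import Data.Product using (Σ; _×_; _,_; proj₁; proj₂)
open import Data.Sum using (_⊎_; inj₁; inj₂)
open import Data.Sum.Properties using (≡-dec; inj₁-injective; inj₂-injective)
open import Data.Unit using (⊤; tt)
open import Data.Empty using (⊥; ⊥-elim)
open import Relation.Nullary using (¬_; yes; no; does)
open import Relation.Binary using (tri<; tri≈; tri>; DecidableEquality)
open import Relation.Binary.PropositionalEquality using (_≡_; _≢_; refl; sym; trans; cong; subst; subst₂; ≢-sym)
open import Relation.Binary.Construct.Closure.ReflexiveTransitive using (ε; _◅_; _◅◅_; reverse)


record SimpleGraph (G : Graph) : Set where
  open Graph G
  field
    ~-sym     : ∀ {u v} → u ~ v → v ~ u
    ~-irrefl  : ∀ {u} → ¬ (u ~ u)

CycAdjℕ : ℕ → ℕ → ℕ → Set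
CycAdjℕ n s t = (suc s ≡ t) ⊎ (suc s ≡ n × t ≡ 0) ⊎ (suc t ≡ s) ⊎ (suc t ≡ n × s ≡ 0)

cycAdj⇒cycAdjℕ : ∀ {n} (x y : Fin n) → CycAdj n x y → CycAdjℕ n (toℕ x) (toℕ y)
cycAdj⇒cycAdjℕ x y (inj₁ (inj₁ e)) = inj₁ e
cycAdj⇒cycAdjℕ x y (inj₁ (inj₂ e)) = inj₂ (inj₁ e)
cycAdj⇒cycAdjℕ x y (inj₂ (inj₁ e)) = inj₂ (inj₂ (inj₁ e))
cycAdj⇒cycAdjℕ x y (inj₂ (inj₂ e)) = inj₂ (inj₂ (inj₂ e))

cycAdjℕ⇒cycAdj : ∀ {n} (x y : Fin n) → CycAdjℕ n (toℕ x) (toℕ y) → CycAdj n x y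
cycAdjℕ⇒cycAdj x y (inj₁ e) = inj₁ (inj₁ e)
cycAdjℕ⇒cycAdj x y (inj₂ (inj₁ e)) = inj₁ (inj₂ e)
cycAdjℕ⇒cycAdj x y (inj₂ (inj₂ (inj₁ e))) = inj₂ (inj₁ e)
cycAdjℕ⇒cycAdj x y (inj₂ (inj₂ (inj₂ e))) = inj₂ (inj₂ e)

module Walk {G : Graph} (C : Hole G) where
  open Graph G
  open Hole C

  0<len : 0 < len
  0<len = ≤-trans (s≤s z≤n) len≥4

  instance
    len-nonZero : NonZero len
    len-nonZero = >-nonZero 0<len

  at : ℕ → Fin len
  at t = fromℕ< (m%n<n t len)

  toℕ-at : ∀ {t} → t < len → toℕ (at t) ≡ t
  toℕ-at {t} t< = trans (toℕ-fromℕ< (m%n<n t len)) (m<n⇒m%n≡m t<)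

  at-toℕ : ∀ (i : Fin len) → at (toℕ i) ≡ i
  at-toℕ i = toℕ-injective (toℕ-at (toℕ<n i))

  walk : ℕ → V
  walk t = vtx (at t)

  walk-len : walk len ≡ walk 0
  walk-len = cong vtx (toℕ-injective (trans (trans (toℕ-fromℕ< (m%n<n len len)) (n%n≡0 len)) (sym (toℕ-at 0<len))))

  walk-injective : ∀ {s t} → s < len → t < len → walk s ≡ walk t → s ≡ t
  walk-injective s< t< e = trans (sym (toℕ-at s<)) (trans (cong toℕ (vtx-inj e)) (toℕ-at t<))

  walk-adjacent : ∀ t → t < len → walk t ~ walk (suc t)
  walk-adjacent t t< with suc t <? len
  ... | yes st< = proj₂ (induced (at t) (at (suc t)))
        (cycAdjℕ⇒cycAdj (at t) (at (suc t)) (inj₁ (trans (cong suc (toℕ-at t<)) (sym (toℕ-at st<)))))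
  ... | no st≮ = subst (walk t ~_) (sym (trans (cong walk closes) walk-len))
        (proj₂ (induced (at t) (at 0)) (cycAdjℕ⇒cycAdj (at t) (at 0)
          (inj₂ (inj₁ (trans (cong suc (toℕ-at t<)) closes , toℕ-at 0<len)))))
    where
    closes : suc t ≡ len
    closes = ≤-antisym t< (≮⇒≥ st≮)

  walk-induced : ∀ {s t} → s < len → t < len → walk s ~ walk t → CycAdjℕ len s t
  walk-induced {s} {t} s< t< a = subst₂ (CycAdjℕ len) (toℕ-at s<) (toℕ-at t<)
    (cycAdj⇒cycAdjℕ (at s) (at t) (proj₁ (induced (at s) (at t)) a))

module FirstFour {G : Graph} (C : Hole G) where
  open Graph G
  open Hole C
  open Walk C

  0<4 : 0 < 4
  0<4 = s≤s z≤n
  1<4 : 1 < 4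
  1<4 = s≤s (s≤s z≤n)
  2<4 : 2 < 4
  2<4 = s≤s (s≤s (s≤s z≤n))
  3<4 : 3 < 4
  3<4 = s≤s (s≤s (s≤s (s≤s z≤n)))

  <len : ∀ {t} → t < 4 → t < len
  <len t<4 = ≤-trans t<4 len≥4

  len≢ : ∀ {x} → x < 4 → len ≢ x
  len≢ x< refl = <⇒≱ x< len≥4

  ¬adj02 : ¬ (walk 0 ~ walk 2)
  ¬adj02 a with walk-induced (<len 0<4) (<len 2<4) a
  ... | inj₁ ()
  ... | inj₂ (inj₁ (e , _)) = len≢ 1<4 (sym e)
  ... | inj₂ (inj₂ (inj₁ ()))
  ... | inj₂ (inj₂ (inj₂ (e , _))) = len≢ 3<4 (sym e)

  ¬adj13 : ¬ (walk 1 ~ walk 3)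
  ¬adj13 a with walk-induced (<len 1<4) (<len 3<4) a
  ... | inj₁ ()
  ... | inj₂ (inj₁ (e , _)) = len≢ 2<4 (sym e)
  ... | inj₂ (inj₂ (inj₁ ()))
  ... | inj₂ (inj₂ (inj₂ (_ , ())))

  ¬adj03 : len ≢ 4 → ¬ (walk 0 ~ walk 3)
  ¬adj03 ne a with walk-induced (<len 0<4) (<len 3<4) a
  ... | inj₁ ()
  ... | inj₂ (inj₁ (e , _)) = len≢ 1<4 (sym e)
  ... | inj₂ (inj₂ (inj₁ ()))
  ... | inj₂ (inj₂ (inj₂ (e , _))) = ne (sym e)

  adj30 : len ≡ 4 → walk 3 ~ walk 0
  adj30 e = subst (walk 3 ~_) (trans (cong walk (sym e)) walk-len) (walk-adjacent 3 (<len 3<4))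

  adj01 : walk 0 ~ walk 1
  adj01 = walk-adjacent 0 (<len 0<4)
  adj12 : walk 1 ~ walk 2
  adj12 = walk-adjacent 1 (<len 1<4)
  adj23 : walk 2 ~ walk 3
  adj23 = walk-adjacent 2 (<len 2<4)

  distinct : ∀ {s t} → s < 4 → t < 4 → s ≢ t → walk s ≢ walk t
  distinct s< t< ne e = ne (walk-injective (<len s<) (<len t<) e)

module Closeness {G : Graph} where
  open Graph G

  closeOfFourShared : (C D : Hole G) (a b c d : V) →
    a ≢ b → a ≢ c → a ≢ d → b ≢ c → b ≢ d → c ≢ d →
    a ∈H C → b ∈H C → c ∈H C → d ∈H C →
    a ∈H D → b ∈H D → c ∈H D → d ∈H D → Close C D
  closeOfFourShared C D a b c d ab ac ad bc bd cd aC bC cC dC aD bD cD dD = f , f-inj , f∈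
    where
    f : Fin 4 → V
    f fz = a
    f (fs fz) = b
    f (fs (fs fz)) = c
    f (fs (fs (fs fz))) = d
    f-inj : ∀ {x y} → f x ≡ f y → x ≡ y
    f-inj {fz} {fz} e = refl
    f-inj {fz} {fs fz} e = ⊥-elim (ab e)
    f-inj {fz} {fs (fs fz)} e = ⊥-elim (ac e)
    f-inj {fz} {fs (fs (fs fz))} e = ⊥-elim (ad e)
    f-inj {fs fz} {fz} e = ⊥-elim (ab (sym e))
    f-inj {fs fz} {fs fz} e = refl
    f-inj {fs fz} {fs (fs fz)} e = ⊥-elim (bc e)
    f-inj {fs fz} {fs (fs (fs fz))} e = ⊥-elim (bd e)
    f-inj {fs (fs fz)} {fz} e = ⊥-elim (ac (sym e))
    f-inj {fs (fs fz)} {fs fz} e = ⊥-elim (bc (sym e))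
    f-inj {fs (fs fz)} {fs (fs fz)} e = refl
    f-inj {fs (fs fz)} {fs (fs (fs fz))} e = ⊥-elim (cd e)
    f-inj {fs (fs (fs fz))} {fz} e = ⊥-elim (ad (sym e))
    f-inj {fs (fs (fs fz))} {fs fz} e = ⊥-elim (bd (sym e))
    f-inj {fs (fs (fs fz))} {fs (fs fz)} e = ⊥-elim (cd (sym e))
    f-inj {fs (fs (fs fz))} {fs (fs (fs fz))} e = refl
    f∈ : ∀ p → (f p ∈H C) × (f p ∈H D)
    f∈ fz = aC , aD
    f∈ (fs fz) = bC , bD
    f∈ (fs (fs fz)) = cC , cD
    f∈ (fs (fs (fs fz))) = dC , dD

  close-sym : ∀ {C D : Hole G} → Close C D → Close D C
  close-sym (f , f-inj , f∈) = f , f-inj , λ p → proj₂ (f∈ p) , proj₁ (f∈ p)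

  allEquivalentViaHub : (R : Hole G) → (∀ C → Equivalent C R) → AllHolesEquivalent G
  allEquivalentViaHub R toR C D = toR C ◅◅ reverse (λ {C} {D} → close-sym {C} {D}) (toR D)

Distinct₄ : {K : Set} → K → K → K → K → Set
Distinct₄ a b c d = a ≢ b × a ≢ c × a ≢ d × b ≢ c × b ≢ d × c ≢ d

module _ {K : Set} (B : K → K → Bool) where

  NoInducedP4 NoInducedC4 : Set
  NoInducedP4 = ∀ {a b c d} → Distinct₄ a b c d →
    B a b ≡ true → B b c ≡ true → B c d ≡ true → B a c ≡ false → B b d ≡ false → B a d ≡ false → ⊥
  NoInducedC4 = ∀ {a b c d} → Distinct₄ a b c d →
    B a b ≡ true → B b c ≡ true → B c d ≡ true → B d a ≡ true → B a c ≡ false → B b d ≡ false → ⊥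

module NoHoleInCograph {G : Graph} (SG : SimpleGraph G)
  {K : Set} (B : K → K → Bool) (noP4 : NoInducedP4 B) (noC4 : NoInducedC4 B)
  (P : Graph.V G → Set) (index : Graph.V G → Maybe K)
  (index-injective : ∀ {u v} → P u → P v → index u ≡ index v → u ≡ v)
  (adj⇒B : ∀ {u v i j} → P u → P v → Graph._~_ G u v → index u ≡ just i → index v ≡ just j → B i j ≡ true)
  (B⇒adj : ∀ {u v i j} → P u → P v → B i j ≡ true → index u ≡ just i → index v ≡ just j → Graph._~_ G u v)
  (unlabelled-universal : ∀ {u v j} → P u → P v → index u ≡ nothing → index v ≡ just j → Graph._~_ G u v)
  where
  open Graph G
  open SimpleGraph SG

  ¬adj⇒¬B : ∀ {u v i j} → P u → P v → ¬ (u ~ v) → index u ≡ just i → index v ≡ just j → B i j ≡ false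
  ¬adj⇒¬B {i = i} {j = j} hu hv na iu iv with B i j in e
  ... | false = refl
  ... | true = ⊥-elim (na (B⇒adj hu hv e iu iv))

  noHoleWithin : (C : Hole G) → (∀ t → P (Hole.vtx C t)) → ⊥
  noHoleWithin C inP = go (index (walk 0)) refl (index (walk 1)) refl (index (walk 2)) refl (index (walk 3)) refl
    where
    open Hole C
    open Walk C
    open FirstFour C
    p : ∀ t → P (walk t)
    p t = inP (at t)
    -- an unlabelled vertex would be adjacent to the vertex two steps further along the hole
    unlabelled-opposite : ∀ {s t} → ¬ (walk s ~ walk t) → s ≢ t → s < 4 → t < 4 → index (walk s) ≡ nothing → ⊥
    unlabelled-opposite {s} {t} na ne s< t< e with index (walk t) in e′
    ... | nothing = distinct s< t< ne (index-injective (p s) (p t) (trans e (sym e′)))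
    ... | just j = na (unlabelled-universal (p s) (p t) e e′)
    labels-differ : ∀ {s t a b} → s < 4 → t < 4 → s ≢ t → index (walk s) ≡ just a → index (walk t) ≡ just b → a ≢ b
    labels-differ {s} {t} s< t< ne ea eb refl = distinct s< t< ne (index-injective (p s) (p t) (trans ea (sym eb)))
    labels-distinct : ∀ {a b c d} → index (walk 0) ≡ just a → index (walk 1) ≡ just b →
      index (walk 2) ≡ just c → index (walk 3) ≡ just d → Distinct₄ a b c d
    labels-distinct e0 e1 e2 e3 =
        labels-differ 0<4 1<4 (λ ()) e0 e1 , labels-differ 0<4 2<4 (λ ()) e0 e2 , labels-differ 0<4 3<4 (λ ()) e0 e3
      , labels-differ 1<4 2<4 (λ ()) e1 e2 , labels-differ 1<4 3<4 (λ ()) e1 e3 , labels-differ 2<4 3<4 (λ ()) e2 e3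
    go : ∀ x0 → index (walk 0) ≡ x0 → ∀ x1 → index (walk 1) ≡ x1 →
         ∀ x2 → index (walk 2) ≡ x2 → ∀ x3 → index (walk 3) ≡ x3 → ⊥
    go nothing e0 _ _ _ _ _ _ = unlabelled-opposite ¬adj02 (λ ()) 0<4 2<4 e0
    go (just _) _ nothing e1 _ _ _ _ = unlabelled-opposite ¬adj13 (λ ()) 1<4 3<4 e1
    go (just _) _ (just _) _ nothing e2 _ _ = unlabelled-opposite (λ a → ¬adj02 (~-sym a)) (λ ()) 2<4 0<4 e2
    go (just _) _ (just _) _ (just _) _ nothing e3 = unlabelled-opposite (λ a → ¬adj13 (~-sym a)) (λ ()) 3<4 1<4 e3
    go (just a) e0 (just b) e1 (just c) e2 (just d) e3 with len Data.Nat.≟ 4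
    ... | yes l = noC4 (labels-distinct e0 e1 e2 e3) (adj⇒B (p 0) (p 1) adj01 e0 e1) (adj⇒B (p 1) (p 2) adj12 e1 e2)
            (adj⇒B (p 2) (p 3) adj23 e2 e3) (adj⇒B (p 3) (p 0) (adj30 l) e3 e0)
            (¬adj⇒¬B (p 0) (p 2) ¬adj02 e0 e2) (¬adj⇒¬B (p 1) (p 3) ¬adj13 e1 e3)
    ... | no l = noP4 (labels-distinct e0 e1 e2 e3) (adj⇒B (p 0) (p 1) adj01 e0 e1) (adj⇒B (p 1) (p 2) adj12 e1 e2)
            (adj⇒B (p 2) (p 3) adj23 e2 e3) (¬adj⇒¬B (p 0) (p 2) ¬adj02 e0 e2)
            (¬adj⇒¬B (p 1) (p 3) ¬adj13 e1 e3) (¬adj⇒¬B (p 0) (p 3) (¬adj03 l) e0 e3)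

-- Ladders

RungStep : {V Rung : Set} → (Rung → ℕ) → (Rung → ℕ → V) → V → V → Set
RungStep {Rung = Rung} top rung u v = Σ Rung λ π → Σ ℕ λ p → p < top π × u ≡ rung π p × v ≡ rung π (suc p)

record Ladder (G : Graph) : Set₁ where
  open Graph G
  field
    Rung  : Set
    _≟ʳ_  : DecidableEquality Rung
    top   : Rung → ℕ
    rung  : Rung → ℕ → V
    level : V → ℕ
    top≥2 : ∀ π → 2 ≤ top π
    rung-position-injective : ∀ {π π′ s t} → s ≤ top π → t ≤ top π′ → rung π s ≡ rung π′ t → s ≡ t
    rung-injective : ∀ {π π′ s t} → rung π s ≡ rung π′ t → π ≡ π′
    rung-adjacent : ∀ π {s} → s < top π → rung π s ~ rung π (suc s)
    rung-induced : ∀ π {s t} → s ≤ top π → t ≤ top π → rung π s ~ rung π t → (suc s ≡ t) ⊎ (suc t ≡ s)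
    rungs-meet-at-ends : ∀ {π π′ s t} → π ≢ π′ → s ≤ top π → t ≤ top π′ → rung π s ~ rung π′ t →
      (s ≡ 0 × t ≡ 0) ⊎ (s ≡ top π × t ≡ top π′)
    level-mono : ∀ π {p q} → p ≤ q → q ≤ top π → level (rung π p) ≤ level (rung π q)
    rung-step-or-flat : ∀ {u v} → u ~ v → RungStep top rung u v ⊎ RungStep top rung v u ⊎ level u ≡ level v

≤ᵇ-differ : ∀ a b c → (a ≤ᵇ c) ≢ (b ≤ᵇ c) → (a ≤ c × c < b) ⊎ (b ≤ c × c < a)
≤ᵇ-differ a b c ne with a ≤ᵇ c in ea | b ≤ᵇ c in eb
... | true | true = ⊥-elim (ne refl)
... | false | false = ⊥-elim (ne refl)
... | true | false = inj₁ (≤ᵇ⇒≤ a c (subst T (sym ea) tt) , ≰⇒> (λ le → subst T eb (≤⇒≤ᵇ le)))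
... | false | true = inj₂ (≤ᵇ⇒≤ b c (subst T (sym eb) tt) , ≰⇒> (λ le → subst T ea (≤⇒≤ᵇ le)))

≤ᵇ-separates : ∀ {a b c} → a ≤ c → c < b → (a ≤ᵇ c) ≢ (b ≤ᵇ c)
≤ᵇ-separates {a} {b} {c} a≤ c< e = <⇒≱ c< (≤ᵇ⇒≤ b c (subst T e (≤⇒≤ᵇ a≤)))

boolChange : (g : ℕ → Bool) → ∀ {a b} → a ≤ b → g a ≢ g b → Σ ℕ λ s → a ≤ s × s < b × g s ≢ g (suc s)
boolChange g {a} {zero} z≤n ne = ⊥-elim (ne refl)
boolChange g {a} {suc b} a≤ ne with a ≤? b
... | no a≰b = ⊥-elim (ne (cong g (≤-antisym a≤ (≰⇒> a≰b))))
... | yes a≤b with Data.Bool._≟_ (g a) (g b)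
...   | yes e = b , a≤b , ≤-refl , λ e′ → ne (trans e e′)
...   | no ne′ with boolChange g a≤b ne′
...     | s , as , sb , ns = s , as , ≤-trans sb (n≤1+n b) , ns

module LadderCuts {G : Graph} (SG : SimpleGraph G) (ℒ : Ladder G) where
  open Graph G
  open SimpleGraph SG
  open Ladder ℒ

  level-cut-by-rung : ∀ {u v c} → u ~ v → level u ≤ c → c < level v → RungStep top rung u v
  level-cut-by-rung a l₁ l₂ with rung-step-or-flat a
  ... | inj₁ step = step
  ... | inj₂ (inj₁ (π , p , p< , refl , refl)) = ⊥-elim (<⇒≱ (≤-<-trans l₁ l₂) (level-mono π (n≤1+n p) p<))
  ... | inj₂ (inj₂ e) = ⊥-elim (<⇒≱ l₂ (subst (_≤ _) e l₁))

  record TwoRungEdges (C : Hole G) : Set where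
    field
      π₁ π₂ : Rung
      π₁≢π₂ : π₁ ≢ π₂
      p₁ p₂ : ℕ
      p₁< : p₁ < top π₁
      p₂< : p₂ < top π₂
      lo₁∈ : rung π₁ p₁ ∈H C
      hi₁∈ : rung π₁ (suc p₁) ∈H C
      lo₂∈ : rung π₂ p₂ ∈H C
      hi₂∈ : rung π₂ (suc p₂) ∈H C

  LevelConstant : Hole G → Set
  LevelConstant C = ∀ s t → level (Hole.vtx C s) ≡ level (Hole.vtx C t)

  module _ (C : Hole G) where
    open Hole C
    open Walk C

    Traverses : ℕ → Rung → ℕ → Set
    Traverses s π p = (walk s ≡ rung π p × walk (suc s) ≡ rung π (suc p))
                    ⊎ (walk (suc s) ≡ rung π p × walk s ≡ rung π (suc p))

    record Crossing (c s : ℕ) : Set where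
      field
        π : Rung
        p : ℕ
        p< : p < top π
        lo : level (rung π p) ≤ c
        hi : c < level (rung π (suc p))
        along : Traverses s π p

      lo∈ : rung π p ∈H C
      lo∈ with along
      ... | inj₁ (e , _) = at s , e
      ... | inj₂ (e , _) = at (suc s) , e

      hi∈ : rung π (suc p) ∈H C
      hi∈ with along
      ... | inj₁ (_ , e) = at (suc s) , e
      ... | inj₂ (_ , e) = at s , e

    below : ℕ → ℕ → Bool
    below c t = level (walk t) ≤ᵇ c

    below-wraps : ∀ c → below c 0 ≡ below c len
    below-wraps c = cong (λ x → level x ≤ᵇ c) (sym walk-len)

    crossing : ∀ {c s} → s < len → below c s ≢ below c (suc s) → Crossing c s
    crossing {c} {s} s< ne with ≤ᵇ-differ (level (walk s)) (level (walk (suc s))) c ne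
    ... | inj₁ (a , b) with level-cut-by-rung (walk-adjacent s s<) a b
    ...   | π , p , p< , e₁ , e₂ = record { π = π ; p = p ; p< = p<
             ; lo = subst (λ x → level x ≤ c) e₁ a ; hi = subst (λ x → c < level x) e₂ b
             ; along = inj₁ (e₁ , e₂) }
    crossing {c} {s} s< ne | inj₂ (b , a) with level-cut-by-rung (~-sym (walk-adjacent s s<)) b a
    ...   | π , p , p< , e₁ , e₂ = record { π = π ; p = p ; p< = p<
             ; lo = subst (λ x → level x ≤ c) e₁ b ; hi = subst (λ x → c < level x) e₂ a
             ; along = inj₂ (e₁ , e₂) }

    cut-edge-unique : ∀ π {p p′ c} → p < top π → p′ < top π →
      level (rung π p) ≤ c → c < level (rung π (suc p)) →
      level (rung π p′) ≤ c → c < level (rung π (suc p′)) → p ≡ p′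
    cut-edge-unique π {p} {p′} p< p′< a b a′ b′ with <-cmp p p′
    ... | tri≈ _ e _ = e
    ... | tri< lt _ _ = ⊥-elim (<⇒≱ b (≤-trans (level-mono π lt (<⇒≤ p′<)) a′))
    ... | tri> _ _ gt = ⊥-elim (<⇒≱ b′ (≤-trans (level-mono π gt (<⇒≤ p<)) a))

    -- Two different steps of a hole of length ≥ 4 never traverse the same edge.
    crossings-on-distinct-rungs : ∀ {c s₁ s₂} → s₁ < s₂ → s₂ < len → (r₁ : Crossing c s₁) (r₂ : Crossing c s₂) →
      Crossing.π r₁ ≢ Crossing.π r₂
    crossings-on-distinct-rungs {c} {s₁} {s₂} lt s₂< r₁ r₂ refl =
      same-edge (Crossing.along r₁) (subst (Traverses s₂ π) (sym same-p) (Crossing.along r₂))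
      where
      π : Rung
      π = Crossing.π r₁
      p : ℕ
      p = Crossing.p r₁
      same-p : p ≡ Crossing.p r₂
      same-p = cut-edge-unique π (Crossing.p< r₁) (Crossing.p< r₂)
        (Crossing.lo r₁) (Crossing.hi r₁) (Crossing.lo r₂) (Crossing.hi r₂)
      s₁< : s₁ < len
      s₁< = <-trans lt s₂<
      1+s₁< : suc s₁ < len
      1+s₁< = ≤-<-trans lt s₂<
      wraps : ¬ (suc s₂ < len) → walk (suc s₂) ≡ walk 0
      wraps nl = trans (cong walk (≤-antisym s₂< (≮⇒≥ nl))) walk-len
      reversed : walk s₁ ≡ walk (suc s₂) → suc s₁ ≡ s₂ → ⊥
      reversed e₁ refl with suc (suc s₁) <? len
      ... | yes l = <-irrefl (walk-injective s₁< l e₁) (<-trans (n<1+n s₁) (n<1+n (suc s₁)))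
      ... | no nl = <⇒≱ (≤-trans (s≤s (s≤s (s≤s z≤n))) len≥4)
                      (≤-reflexive (trans (sym (≤-antisym s₂< (≮⇒≥ nl))) (cong (λ z → suc (suc z)) s₁≡0)))
        where
        s₁≡0 : s₁ ≡ 0
        s₁≡0 = walk-injective s₁< 0<len (trans e₁ (wraps nl))
      same-edge : Traverses s₁ π p → Traverses s₂ π p → ⊥
      same-edge (inj₁ (a , _)) (inj₁ (b , _)) = <⇒≢ lt (walk-injective s₁< s₂< (trans a (sym b)))
      same-edge (inj₂ (a , _)) (inj₂ (b , _)) with suc s₂ <? len
      ... | yes l = <⇒≢ lt (suc-injective (walk-injective 1+s₁< l (trans a (sym b))))
      ... | no nl = 1+n≢0 (walk-injective 1+s₁< 0<len (trans a (trans (sym b) (wraps nl))))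
      same-edge (inj₁ (a , a′)) (inj₂ (b , b′)) = reversed (trans a (sym b)) (walk-injective 1+s₁< s₂< (trans a′ (sym b′)))
      same-edge (inj₂ (a , a′)) (inj₁ (b , b′)) = reversed (trans a′ (sym b′)) (walk-injective 1+s₁< s₂< (trans a (sym b)))

    -- A closed walk that leaves one side of a cut must come back.
    twoCrossings : ∀ {c u} → u < len → below c u ≢ below c 0 →
      Σ ℕ λ s₁ → Σ ℕ λ s₂ → s₁ < s₂ × s₂ < len × Crossing c s₁ × Crossing c s₂
    twoCrossings {c} {u} u< ne with boolChange (below c) z≤n (λ e → ne (sym e))
    ... | s , _ , s<u , ns with Data.Bool._≟_ (below c s) (below c 0)
    ...   | no ne′ with boolChange (below c) z≤n (λ e → ne′ (sym e))
    ...     | s′ , _ , s′<s , ns′ = s′ , s , s′<s , <-trans s<u u<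
                                   , crossing (<-trans s′<s (<-trans s<u u<)) ns′ , crossing (<-trans s<u u<) ns
    twoCrossings {c} {u} u< ne | s , _ , s<u , ns | yes e
      with boolChange (below c) (<-trans s<u u<) (λ e′ → ns (trans e (trans (below-wraps c) (sym e′))))
    ... | s′ , s<s′ , s′< , ns′ = s , s′ , s<s′ , s′< , crossing (<-trans s<u u<) ns , crossing s′< ns′

    twoRungEdgesAcross : ∀ c {u} → u < len → below c u ≢ below c 0 → TwoRungEdges C
    twoRungEdgesAcross c u< ne with twoCrossings u< ne
    ... | s₁ , s₂ , lt , s₂< , r₁ , r₂ = record
      { π₁ = Crossing.π r₁ ; π₂ = Crossing.π r₂ ; π₁≢π₂ = crossings-on-distinct-rungs lt s₂< r₁ r₂
      ; p₁ = Crossing.p r₁ ; p₂ = Crossing.p r₂ ; p₁< = Crossing.p< r₁ ; p₂< = Crossing.p< r₂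
      ; lo₁∈ = Crossing.lo∈ r₁ ; hi₁∈ = Crossing.hi∈ r₁ ; lo₂∈ = Crossing.lo∈ r₂ ; hi₂∈ = Crossing.hi∈ r₂ }

    twoRungEdgesOrLevelConstant : TwoRungEdges C ⊎ LevelConstant C
    twoRungEdgesOrLevelConstant with all? (λ t → level (vtx t) Data.Nat.≟ level (walk 0))
    ... | yes same = inj₂ λ s t → trans (same s) (sym (same t))
    ... | no notAll with ¬∀⟶∃¬ len _ (λ t → level (vtx t) Data.Nat.≟ level (walk 0)) notAll
    ...   | t , ne with <-cmp (level (walk (toℕ t))) (level (walk 0))
    ...     | tri≈ _ e _ = ⊥-elim (ne (subst (λ x → level (vtx x) ≡ level (walk 0)) (at-toℕ t) e))
    ...     | tri< lt _ _ = inj₁ (twoRungEdgesAcross (level (walk (toℕ t))) (toℕ<n t) (≤ᵇ-separates ≤-refl lt))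
    ...     | tri> _ _ gt = inj₁ (twoRungEdgesAcross (level (walk 0)) (toℕ<n t) (λ e → ≤ᵇ-separates ≤-refl gt (sym e)))

-- Gluing induced paths into holes

module InducedPaths {G : Graph} (SG : SimpleGraph G) where
  open Graph G
  open SimpleGraph SG

  record InducedPath : Set where
    field
      size : ℕ
      vertex : ℕ → V
      injective : ∀ {s t} → s < size → t < size → vertex s ≡ vertex t → s ≡ t
      adjacent : ∀ s → suc s < size → vertex s ~ vertex (suc s)
      induced : ∀ {s t} → s < size → t < size → vertex s ~ vertex t → (suc s ≡ t) ⊎ (suc t ≡ s)

  _∈P_ : V → InducedPath → Set
  x ∈P S = Σ ℕ λ t → t < InducedPath.size S × InducedPath.vertex S t ≡ x

  module _ (S T : InducedPath) where
    private
      module S = InducedPath S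
      module T = InducedPath T

    Disjoint LastToFirst OnlyLastToFirst OnlyAtJoints : Set
    Disjoint = ∀ {s t} → s < S.size → t < T.size → S.vertex s ≢ T.vertex t
    LastToFirst = ∀ s → suc s ≡ S.size → 0 < T.size → S.vertex s ~ T.vertex 0
    OnlyLastToFirst = ∀ {s t} → s < S.size → t < T.size → S.vertex s ~ T.vertex t → suc s ≡ S.size × t ≡ 0
    OnlyAtJoints = ∀ {s t} → s < S.size → t < T.size → S.vertex s ~ T.vertex t →
      (suc s ≡ S.size × t ≡ 0) ⊎ (s ≡ 0 × suc t ≡ T.size)

  singleton : V → InducedPath
  singleton x = record { size = 1 ; vertex = λ _ → x
    ; injective = λ { {zero} {zero} _ _ _ → refl ; {suc _} (s≤s ()) _ _ ; {zero} {suc _} _ (s≤s ()) _ }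
    ; adjacent = λ { s (s≤s ()) }
    ; induced = λ _ _ a → ⊥-elim (~-irrefl a) }

  -- The empty path still needs a vertex function; any vertex d will do.
  optionalPath : V → Maybe V → InducedPath
  optionalPath d nothing = record { size = 0 ; vertex = λ _ → d
    ; injective = λ () ; adjacent = λ _ () ; induced = λ () }
  optionalPath d (just x) = singleton x

  module _ (d : V) where
    OptionalAt : Maybe V → ℕ → Set
    OptionalAt m t = Σ V λ x → m ≡ just x × t ≡ 0 × InducedPath.size (optionalPath d m) ≡ 1
                             × InducedPath.vertex (optionalPath d m) t ≡ x

    optional-view : ∀ m {t} → t < InducedPath.size (optionalPath d m) → OptionalAt m t
    optional-view nothing ()
    optional-view (just x) {zero} _ = x , refl , refl , refl , refl
    optional-view (just x) {suc t} (s≤s ())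

    optional-size : ∀ m → (m ≡ nothing × InducedPath.size (optionalPath d m) ≡ 0)
                        ⊎ (Σ V λ x → m ≡ just x × InducedPath.size (optionalPath d m) ≡ 1)
    optional-size nothing = inj₁ (refl , refl)
    optional-size (just x) = inj₂ (x , refl , refl)

    optional-empty : ∀ {m} → InducedPath.size (optionalPath d m) ≡ 0 → m ≡ nothing
    optional-empty {nothing} _ = refl
    optional-empty {just x} ()

    optional-size-nothing : ∀ {m} → m ≡ nothing → InducedPath.size (optionalPath d m) ≡ 0
    optional-size-nothing refl = refl

    ∈optional : ∀ {m x} → m ≡ just x → x ∈P optionalPath d m
    ∈optional refl = 0 , s≤s z≤n , refl

  n∸s≡1+n∸1+s : ∀ n {s} → s < n → n ∸ s ≡ suc (n ∸ suc s)
  n∸s≡1+n∸1+s (suc n) {zero} _ = refl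
  n∸s≡1+n∸1+s (suc n) {suc s} (s≤s lt) = n∸s≡1+n∸1+s n lt

  n∸1+s<n : ∀ n {s} → s < n → n ∸ suc s < n
  n∸1+s<n (suc n) {s} _ = s≤s (m∸n≤m n s)

  reversePath : InducedPath → InducedPath
  reversePath S = record { size = size ; vertex = λ t → vertex (size ∸ suc t)
    ; injective = λ {s} {t} s< t< e → suc-injective (∸-cancelˡ-≡ s< t< (injective (n∸1+s<n size s<) (n∸1+s<n size t<) e))
    ; adjacent = λ s 1+s< → subst (λ x → vertex x ~ vertex (size ∸ suc (suc s))) (sym (n∸s≡1+n∸1+s size 1+s<))
        (~-sym (adjacent (size ∸ suc (suc s))
          (subst (_< size) (n∸s≡1+n∸1+s size 1+s<) (n∸1+s<n size (<-trans (n<1+n s) 1+s<)))))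
    ; induced = λ s< t< a → flip s< t< (induced (n∸1+s<n size s<) (n∸1+s<n size t<) a) }
    where
    open InducedPath S
    flip : ∀ {s t} → s < size → t < size →
      (suc (size ∸ suc s) ≡ size ∸ suc t) ⊎ (suc (size ∸ suc t) ≡ size ∸ suc s) → (suc s ≡ t) ⊎ (suc t ≡ s)
    flip s< t< (inj₁ e) = inj₂ (sym (∸-cancelˡ-≡ (<⇒≤ s<) t< (trans (n∸s≡1+n∸1+s size s<) e)))
    flip s< t< (inj₂ e) = inj₁ (sym (∸-cancelˡ-≡ (<⇒≤ t<) s< (trans (n∸s≡1+n∸1+s size t<) e)))

  module Concat (S T : InducedPath) (S≢T : Disjoint S T) (last~first : LastToFirst S T) where
    module S = InducedPath S
    module T = InducedPath T

    size : ℕ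
    size = S.size + T.size

    vertex : ℕ → V
    vertex t with t <? S.size
    ... | yes _ = S.vertex t
    ... | no _ = T.vertex (t ∸ S.size)

    vertex-left : ∀ {t} → t < S.size → vertex t ≡ S.vertex t
    vertex-left {t} lt with t <? S.size
    ... | yes _ = refl
    ... | no nl = ⊥-elim (nl lt)

    vertex-right : ∀ u → vertex (S.size + u) ≡ T.vertex u
    vertex-right u with (S.size + u) <? S.size
    ... | yes l = ⊥-elim (<⇒≱ l (m≤m+n S.size u))
    ... | no _ = cong T.vertex (m+n∸m≡n S.size u)

    position : ∀ t → (t < S.size) ⊎ (Σ ℕ λ u → t ≡ S.size + u)
    position t with t <? S.size
    ... | yes l = inj₁ l
    ... | no nl = inj₂ (t ∸ S.size , sym (m+[n∸m]≡n (≮⇒≥ nl)))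

    right< : ∀ {u} → S.size + u < size → u < T.size
    right< {u} l = +-cancelˡ-< S.size u T.size l

    injective : ∀ {s t} → s < size → t < size → vertex s ≡ vertex t → s ≡ t
    injective {s} {t} s< t< e with position s | position t
    ... | inj₁ a | inj₁ b = S.injective a b (trans (sym (vertex-left a)) (trans e (vertex-left b)))
    ... | inj₁ a | inj₂ (v , refl) = ⊥-elim (S≢T a (right< t<) (trans (sym (vertex-left a)) (trans e (vertex-right v))))
    ... | inj₂ (u , refl) | inj₁ b = ⊥-elim (S≢T b (right< s<) (trans (sym (vertex-left b)) (trans (sym e) (vertex-right u))))
    ... | inj₂ (u , refl) | inj₂ (v , refl) =
          cong (S.size +_) (T.injective (right< s<) (right< t<) (trans (sym (vertex-right u)) (trans e (vertex-right v))))

    adjacent : ∀ s → suc s < size → vertex s ~ vertex (suc s)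
    adjacent s l with position s
    ... | inj₂ (u , refl) = subst₂ _~_ (sym (vertex-right u)) (sym (trans (cong vertex (sym (+-suc S.size u))) (vertex-right (suc u))))
                              (T.adjacent u (right< (subst (_< size) (sym (+-suc S.size u)) l)))
    ... | inj₁ a with m≤n⇒m<n∨m≡n a
    ...   | inj₁ b = subst₂ _~_ (sym (vertex-left a)) (sym (vertex-left b)) (S.adjacent s b)
    ...   | inj₂ e = subst₂ _~_ (sym (vertex-left a)) (sym (trans (cong vertex (trans e (sym (+-identityʳ S.size)))) (vertex-right 0)))
                       (last~first s e (right< (subst (_< size) (trans e (sym (+-identityʳ S.size))) l)))

    data Edge (s t : ℕ) : Set where
      within-S : s < S.size → t < S.size → (suc s ≡ t) ⊎ (suc t ≡ s) → Edge s t
      within-T : ∀ u v → s ≡ S.size + u → t ≡ S.size + v → (suc u ≡ v) ⊎ (suc v ≡ u) → Edge s t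
      S-to-T : ∀ v → s < S.size → t ≡ S.size + v → v < T.size → S.vertex s ~ T.vertex v → Edge s t
      T-to-S : ∀ u → t < S.size → s ≡ S.size + u → u < T.size → S.vertex t ~ T.vertex u → Edge s t

    edge : ∀ {s t} → s < size → t < size → vertex s ~ vertex t → Edge s t
    edge {s} {t} s< t< a with position s | position t
    ... | inj₁ x | inj₁ y = within-S x y (S.induced x y (subst₂ _~_ (vertex-left x) (vertex-left y) a))
    ... | inj₁ x | inj₂ (v , refl) = S-to-T v x refl (right< t<) (subst₂ _~_ (vertex-left x) (vertex-right v) a)
    ... | inj₂ (u , refl) | inj₁ y = T-to-S u y refl (right< s<) (~-sym (subst₂ _~_ (vertex-right u) (vertex-left y) a))
    ... | inj₂ (u , refl) | inj₂ (v , refl) =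
          within-T u v refl refl (T.induced (right< s<) (right< t<) (subst₂ _~_ (vertex-right u) (vertex-right v) a))

    shift : ∀ {u v} → suc u ≡ v → suc (S.size + u) ≡ S.size + v
    shift {u} e = trans (sym (+-suc S.size u)) (cong (S.size +_) e)

    at-joint : ∀ {s} → suc s ≡ S.size → suc s ≡ S.size + 0
    at-joint e = trans e (sym (+-identityʳ S.size))

    ∈left : ∀ {x} → x ∈P S → Σ ℕ λ t → t < size × vertex t ≡ x
    ∈left (t , t< , e) = t , ≤-trans t< (m≤m+n S.size T.size) , trans (vertex-left t<) e
    ∈right : ∀ {x} → x ∈P T → Σ ℕ λ t → t < size × vertex t ≡ x
    ∈right (t , t< , e) = S.size + t , +-monoʳ-< S.size t< , trans (vertex-right t) e

  concat : (S T : InducedPath) → Disjoint S T → LastToFirst S T → OnlyLastToFirst S T → InducedPath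
  concat S T S≢T last~first only-joint = record
    { size = size ; vertex = vertex ; injective = injective ; adjacent = adjacent ; induced = induced }
    where
    open Concat S T S≢T last~first
    induced : ∀ {s t} → s < size → t < size → vertex s ~ vertex t → (suc s ≡ t) ⊎ (suc t ≡ s)
    induced s< t< a with edge s< t< a
    ... | within-S _ _ r = r
    ... | within-T u v refl refl (inj₁ e) = inj₁ (shift e)
    ... | within-T u v refl refl (inj₂ e) = inj₂ (shift e)
    ... | S-to-T v x refl v< b with only-joint x v< b
    ...   | e , refl = inj₁ (at-joint e)
    induced s< t< a | T-to-S u y refl u< b with only-joint y u< b
    ...   | e , refl = inj₂ (at-joint e)

  module ConcatFacts (S T : InducedPath) (S≢T : Disjoint S T) (last~first : LastToFirst S T)
           (only-joint : OnlyLastToFirst S T) where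
    private
      S+T : InducedPath
      S+T = concat S T S≢T last~first only-joint
      module C = Concat S T S≢T last~first

    concat-view : ∀ {t} → t < InducedPath.size S+T →
      (t < InducedPath.size S × InducedPath.vertex S+T t ≡ InducedPath.vertex S t)
      ⊎ (Σ ℕ λ u → u < InducedPath.size T × t ≡ InducedPath.size S + u × InducedPath.vertex S+T t ≡ InducedPath.vertex T u)
    concat-view {t} t< with C.position t
    ... | inj₁ a = inj₁ (a , C.vertex-left a)
    ... | inj₂ (u , refl) = inj₂ (u , C.right< t< , refl , C.vertex-right u)

    ∈concatˡ : ∀ {x} → x ∈P S → x ∈P S+T
    ∈concatˡ = C.∈left
    ∈concatʳ : ∀ {x} → x ∈P T → x ∈P S+T
    ∈concatʳ = C.∈right

  module CloseUp (S T : InducedPath) (S≢T : Disjoint S T)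
    (last~first : LastToFirst S T) (last~firstᵀ : LastToFirst T S) (only-joints : OnlyAtJoints S T)
    (S-nonempty : 1 ≤ InducedPath.size S) (T-nonempty : 1 ≤ InducedPath.size T)
    (long : 4 ≤ InducedPath.size S + InducedPath.size T) where
    open Concat S T S≢T last~first

    wrap : ∀ s → suc s ≡ size → vertex s ~ vertex 0
    wrap s e with position s
    ... | inj₁ a = ⊥-elim (<⇒≱ (≤-<-trans a (subst (S.size <_) (+-comm T.size S.size) (m<n+m S.size T-nonempty)))
                       (≤-reflexive (sym e)))
    ... | inj₂ (u , refl) = subst₂ _~_ (sym (vertex-right u)) (sym (vertex-left S-nonempty))
          (last~firstᵀ u (+-cancelˡ-≡ S.size _ _ (trans (+-suc S.size u) e)) S-nonempty)

    cyclic : ∀ {s t} → s < size → t < size → vertex s ~ vertex t → CycAdjℕ size s t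
    cyclic s< t< a with edge s< t< a
    ... | within-S _ _ (inj₁ e) = inj₁ e
    ... | within-S _ _ (inj₂ e) = inj₂ (inj₂ (inj₁ e))
    ... | within-T u v refl refl (inj₁ e) = inj₁ (shift e)
    ... | within-T u v refl refl (inj₂ e) = inj₂ (inj₂ (inj₁ (shift e)))
    ... | S-to-T v x refl v< b with only-joints x v< b
    ...   | inj₁ (e , refl) = inj₁ (at-joint e)
    ...   | inj₂ (refl , e) = inj₂ (inj₂ (inj₂ (shift e , refl)))
    cyclic s< t< a | T-to-S u y refl u< b with only-joints y u< b
    ...   | inj₁ (e , refl) = inj₂ (inj₂ (inj₁ (at-joint e)))
    ...   | inj₂ (refl , e) = inj₂ (inj₁ (shift e , refl))

    cyclic⁻¹ : ∀ {s t} → s < size → t < size → CycAdjℕ size s t → vertex s ~ vertex t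
    cyclic⁻¹ s< t< (inj₁ refl) = adjacent _ t<
    cyclic⁻¹ s< t< (inj₂ (inj₁ (e , refl))) = wrap _ e
    cyclic⁻¹ s< t< (inj₂ (inj₂ (inj₁ refl))) = ~-sym (adjacent _ s<)
    cyclic⁻¹ s< t< (inj₂ (inj₂ (inj₂ (e , refl)))) = ~-sym (wrap _ e)

    hole : Hole G
    hole = record
      { len = size ; len≥4 = long ; vtx = λ i → vertex (toℕ i)
      ; vtx-inj = λ {i} {j} e → toℕ-injective (injective (toℕ<n i) (toℕ<n j) e)
      ; induced = λ i j → (λ a → cycAdjℕ⇒cycAdj i j (cyclic (toℕ<n i) (toℕ<n j) a))
                        , (λ c → cyclic⁻¹ (toℕ<n i) (toℕ<n j) (cycAdj⇒cycAdjℕ i j c)) }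

    ∈hole : ∀ {x} → (Σ ℕ λ t → t < size × vertex t ≡ x) → x ∈H hole
    ∈hole (t , t< , e) = fromℕ< t< , trans (cong vertex (toℕ-fromℕ< t<)) e

    ∈holeˡ : ∀ {x} → x ∈P S → x ∈H hole
    ∈holeˡ m = ∈hole (∈left m)
    ∈holeʳ : ∀ {x} → x ∈P T → x ∈H hole
    ∈holeʳ m = ∈hole (∈right m)

module Gluing {G : Graph} (SG : SimpleGraph G) where
  open Graph G
  open SimpleGraph SG
  open InducedPaths SG

  -- The cycle X, [top], D, [bottom]: X runs into D directly (top ≡ nothing)
  -- or through the extra vertex top, and D back into X directly or through bottom.
  record GluingData (X D : InducedPath) (top bottom : Maybe V) : Set where
    private
      module X = InducedPath X
      module D = InducedPath D
    field
      X-nonempty : 1 ≤ X.size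
      D-nonempty : 1 ≤ D.size
      long : 4 ≤ X.size + D.size
      X≢D : Disjoint X D
      X~D-at-direct-ends : ∀ s t → s < X.size → t < D.size → X.vertex s ~ D.vertex t →
        (top ≡ nothing × suc s ≡ X.size × t ≡ 0) ⊎ (bottom ≡ nothing × s ≡ 0 × suc t ≡ D.size)
      top∉X : ∀ {x} → top ≡ just x → ∀ s → s < X.size → x ≢ X.vertex s
      top∉D : ∀ {x} → top ≡ just x → ∀ t → t < D.size → x ≢ D.vertex t
      top~X-only-last : ∀ {x} → top ≡ just x → ∀ s → s < X.size → x ~ X.vertex s → suc s ≡ X.size
      top~D-only-first : ∀ {x} → top ≡ just x → ∀ t → t < D.size → x ~ D.vertex t → t ≡ 0
      bottom∉X : ∀ {y} → bottom ≡ just y → ∀ s → s < X.size → y ≢ X.vertex s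
      bottom∉D : ∀ {y} → bottom ≡ just y → ∀ t → t < D.size → y ≢ D.vertex t
      bottom~X-only-first : ∀ {y} → bottom ≡ just y → ∀ s → s < X.size → y ~ X.vertex s → s ≡ 0
      bottom~D-only-last : ∀ {y} → bottom ≡ just y → ∀ t → t < D.size → y ~ D.vertex t → suc t ≡ D.size
      top-bottom-apart : ∀ {x y} → top ≡ just x → bottom ≡ just y → ¬ (x ~ y) × x ≢ y
      X-last~D-first : top ≡ nothing → ∀ s → suc s ≡ X.size → X.vertex s ~ D.vertex 0
      X-last~top : ∀ {x} → top ≡ just x → ∀ s → suc s ≡ X.size → X.vertex s ~ x
      top~D-first : ∀ {x} → top ≡ just x → x ~ D.vertex 0
      D-last~X-first : bottom ≡ nothing → ∀ t → suc t ≡ D.size → D.vertex t ~ X.vertex 0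
      D-last~bottom : ∀ {y} → bottom ≡ just y → ∀ t → suc t ≡ D.size → D.vertex t ~ y
      bottom~X-first : ∀ {y} → bottom ≡ just y → y ~ X.vertex 0

  module Glue (X D : InducedPath) (tp bt : Maybe V) (g : GluingData X D tp bt) where
    open GluingData g
    module X = InducedPath X
    module D = InducedPath D

    [tp] [bt] : InducedPath
    [tp] = optionalPath (X.vertex 0) tp
    [bt] = optionalPath (X.vertex 0) bt
    n[tp] n[bt] : ℕ
    n[tp] = InducedPath.size [tp]
    n[bt] = InducedPath.size [bt]

    view[tp] : ∀ {t} → t < n[tp] → OptionalAt (X.vertex 0) tp t
    view[tp] = optional-view (X.vertex 0) tp
    view[bt] : ∀ {t} → t < n[bt] → OptionalAt (X.vertex 0) bt t
    view[bt] = optional-view (X.vertex 0) bt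

    [tp]≢D : Disjoint [tp] D
    [tp]≢D s< t< eq with view[tp] s<
    ... | x , e , _ , _ , fe = top∉D e _ t< (trans (sym fe) eq)

    [tp]→D : LastToFirst [tp] D
    [tp]→D s e _ with view[tp] (≤-reflexive e)
    ... | x , ej , _ , _ , fe = subst (_~ D.vertex 0) (sym fe) (top~D-first ej)

    [tp]→D-only : OnlyLastToFirst [tp] D
    [tp]→D-only s< t< a with view[tp] s<
    ... | x , ej , refl , n1 , fe = sym n1 , top~D-only-first ej _ t< (subst (_~ D.vertex _) fe a)

    TD : InducedPath
    TD = concat [tp] D [tp]≢D [tp]→D [tp]→D-only
    module TD = ConcatFacts [tp] D [tp]≢D [tp]→D [tp]→D-only
    nTD : ℕ
    nTD = InducedPath.size TD

    TD-view : ∀ {s} → s < nTD → (Σ V λ x → tp ≡ just x × s ≡ 0 × n[tp] ≡ 1 × InducedPath.vertex TD s ≡ x)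
                              ⊎ (Σ ℕ λ u → u < D.size × s ≡ n[tp] + u × InducedPath.vertex TD s ≡ D.vertex u)
    TD-view s< with TD.concat-view s<
    ... | inj₁ (a , e) with view[tp] a
    ...   | x , ej , s0 , n1 , fe = inj₁ (x , ej , s0 , n1 , trans e fe)
    TD-view s< | inj₂ r = inj₂ r

    TD≢[bt] : Disjoint TD [bt]
    TD≢[bt] s< t< eq with view[bt] t<
    ... | y , ej , _ , _ , fe with TD-view s<
    ...   | inj₁ (x , ex , _ , _ , fx) = proj₂ (top-bottom-apart ex ej) (trans (sym fx) (trans eq fe))
    ...   | inj₂ (u , u< , _ , fu) = bottom∉D ej u u< (sym (trans (sym fu) (trans eq fe)))

    TD→[bt] : LastToFirst TD [bt]
    TD→[bt] s e b< with view[bt] b<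
    ... | y , ej , _ , _ , fe with TD-view (≤-reflexive e)
    ...   | inj₁ (x , ex , refl , n1 , fx) = ⊥-elim (<⇒≢ D-nonempty (suc-injective (trans e (cong (_+ D.size) n1))))
    ...   | inj₂ (u , u< , refl , fu) = subst₂ _~_ (sym fu) (sym fe)
              (D-last~bottom ej u (+-cancelˡ-≡ n[tp] _ _ (trans (+-suc n[tp] u) e)))

    TD→[bt]-only : OnlyLastToFirst TD [bt]
    TD→[bt]-only s< t< a with view[bt] t<
    ... | y , ej , refl , _ , fe with TD-view s<
    ...   | inj₁ (x , ex , _ , _ , fx) = ⊥-elim (proj₁ (top-bottom-apart ex ej) (subst₂ _~_ fx fe a))
    ...   | inj₂ (u , u< , refl , fu) =
            trans (sym (+-suc n[tp] u)) (cong (n[tp] +_) (bottom~D-only-last ej u u< (~-sym (subst₂ _~_ fu fe a)))) , refl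

    Y : InducedPath
    Y = concat TD [bt] TD≢[bt] TD→[bt] TD→[bt]-only
    module Y = ConcatFacts TD [bt] TD≢[bt] TD→[bt] TD→[bt]-only
    nY : ℕ
    nY = InducedPath.size Y

    data Y-position (t : ℕ) : Set where
      at-top : ∀ x → tp ≡ just x → t ≡ 0 → n[tp] ≡ 1 → InducedPath.vertex Y t ≡ x → Y-position t
      on-D : ∀ u → u < D.size → t ≡ n[tp] + u → InducedPath.vertex Y t ≡ D.vertex u → Y-position t
      at-bottom : ∀ y → bt ≡ just y → suc t ≡ nY → n[bt] ≡ 1 → InducedPath.vertex Y t ≡ y → Y-position t

    Y-view : ∀ {t} → t < nY → Y-position t
    Y-view t< with Y.concat-view t<
    ... | inj₁ (a , e) with TD-view a
    ...   | inj₁ (x , ex , t0 , n1 , fx) = at-top x ex t0 n1 (trans e fx)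
    ...   | inj₂ (u , u< , te , fu) = on-D u u< te (trans e fu)
    Y-view t< | inj₂ (u , u< , refl , e) with view[bt] u<
    ...   | y , ej , refl , n1 , fe = at-bottom y ej (trans (sym (+-suc nTD 0)) (cong (nTD +_) (sym n1))) n1 (trans e fe)

    D≤Y : D.size ≤ nY
    D≤Y = ≤-trans (m≤n+m D.size n[tp]) (m≤m+n (n[tp] + D.size) n[bt])

    X≢Y : Disjoint X Y
    X≢Y {s} s< t< eq with Y-view t<
    ... | at-top x ex _ _ fx = top∉X ex s s< (sym (trans eq fx))
    ... | on-D u u< _ fu = X≢D s< u< (trans eq fu)
    ... | at-bottom y ey _ _ fy = bottom∉X ey s s< (sym (trans eq fy))

    X→Y : LastToFirst X Y
    X→Y s e y< with Y-view y<
    ... | at-top x ex _ _ fx = subst (X.vertex s ~_) (sym fx) (X-last~top ex s e)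
    ... | on-D u u< te fu = subst (X.vertex s ~_) (sym (trans fu (cong D.vertex u≡0)))
            (X-last~D-first (optional-empty (X.vertex 0) (m+n≡0⇒m≡0 n[tp] (sym te))) s e)
      where
      u≡0 : u ≡ 0
      u≡0 = m+n≡0⇒n≡0 n[tp] (sym te)
    ... | at-bottom y ey e1 n1 fy = ⊥-elim (<⇒≱ (≤-trans D-nonempty (m≤n+m D.size n[tp]))
            (≤-reflexive (sym (suc-injective (trans e1 (trans (cong (nTD +_) n1) (+-comm nTD 1)))))))

    Y→X : LastToFirst Y X
    Y→X t e _ with Y-view (≤-reflexive e)
    ... | at-bottom y ey _ _ fy = subst (_~ X.vertex 0) (sym fy) (bottom~X-first ey)
    ... | at-top x ex refl n1 fx = ⊥-elim (<⇒≱ (≤-trans (+-mono-≤ (≤-reflexive (sym n1)) D-nonempty) (m≤m+n nTD n[bt]))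
            (≤-reflexive (sym e)))
    ... | on-D u u< refl fu with optional-size (X.vertex 0) bt
    ...   | inj₂ (y , _ , n1) = ⊥-elim (<⇒≢ u< (+-cancelˡ-≡ n[tp] _ _
              (suc-injective (trans e (trans (cong (nTD +_) n1) (+-comm (n[tp] + D.size) 1))))))
    ...   | inj₁ (eb , n0) = subst (_~ X.vertex 0) (sym fu)
              (D-last~X-first eb u (+-cancelˡ-≡ n[tp] _ _ (trans (+-suc n[tp] u)
                (trans e (trans (cong (nTD +_) n0) (+-identityʳ (n[tp] + D.size)))))))

    X~Y-at-joints : OnlyAtJoints X Y
    X~Y-at-joints {s} s< t< a with Y-view t<
    ... | at-top x ex t0 _ fx = inj₁ (top~X-only-last ex s s< (~-sym (subst (X.vertex s ~_) fx a)) , t0)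
    ... | at-bottom y ey e1 _ fy = inj₂ (bottom~X-only-first ey s s< (~-sym (subst (X.vertex s ~_) fy a)) , e1)
    ... | on-D u u< te fu with X~D-at-direct-ends s u s< u< (subst (X.vertex s ~_) fu a)
    ...   | inj₁ (et , e , refl) = inj₁ (e , trans te (trans (+-identityʳ n[tp]) (optional-size-nothing (X.vertex 0) et)))
    ...   | inj₂ (eb , refl , e) = inj₂ (refl , trans (cong suc te) (trans (sym (+-suc n[tp] u))
              (trans (cong (n[tp] +_) e) (trans (sym (+-identityʳ (n[tp] + D.size)))
                (cong ((n[tp] + D.size) +_) (sym (optional-size-nothing (X.vertex 0) eb)))))))

    module Closed = CloseUp X Y X≢Y X→Y Y→X X~Y-at-joints X-nonempty (≤-trans D-nonempty D≤Y)
      (≤-trans long (+-monoʳ-≤ X.size D≤Y))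

    hole : Hole G
    hole = Closed.hole

    X⊆hole : ∀ s → s < X.size → X.vertex s ∈H hole
    X⊆hole s s< = Closed.∈holeˡ (s , s< , refl)
    D⊆hole : ∀ t → t < D.size → D.vertex t ∈H hole
    D⊆hole t t< = Closed.∈holeʳ (Y.∈concatˡ (TD.∈concatʳ (t , t< , refl)))
    top∈hole : ∀ {x} → tp ≡ just x → x ∈H hole
    top∈hole e = Closed.∈holeʳ (Y.∈concatˡ (TD.∈concatˡ (∈optional (X.vertex 0) e)))
    bottom∈hole : ∀ {y} → bt ≡ just y → y ∈H hole
    bottom∈hole e = Closed.∈holeʳ (Y.∈concatʳ (∈optional (X.vertex 0) e))

module LadderHoles {G : Graph} (SG : SimpleGraph G) (ℒ : Ladder G) where
  open Graph G
  open SimpleGraph SG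
  open Ladder ℒ
  open InducedPaths SG
  open Gluing SG
  open Closeness {G}
  open LadderCuts SG ℒ

  rungPath : Rung → InducedPath
  rungPath π = record { size = suc (top π) ; vertex = rung π
    ; injective = λ s< t< → rung-position-injective (s≤s⁻¹ s<) (s≤s⁻¹ t<)
    ; adjacent = λ s 1+s< → rung-adjacent π (s≤s⁻¹ 1+s<)
    ; induced = λ s< t< → rung-induced π (s≤s⁻¹ s<) (s≤s⁻¹ t<) }

  record Attached (z : V) (π : Rung) (e : ℕ) : Set where
    field
      touches : rung π e ~ z
      touches-only : ∀ {s} → s ≤ top π → z ~ rung π s → s ≡ e
      off-rung : ∀ s → z ≢ rung π s

  bottom : Rung → ℕ
  bottom _ = 0

  data Link (end : Rung → ℕ) (π₁ π₂ : Rung) : Maybe V → Set where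
    direct : rung π₁ (end π₁) ~ rung π₂ (end π₂) → Link end π₁ π₂ nothing
    through : ∀ {z} → ¬ (rung π₁ (end π₁) ~ rung π₂ (end π₂)) →
      Attached z π₁ (end π₁) → Attached z π₂ (end π₂) → Link end π₁ π₂ (just z)

  Apart : Maybe V → Maybe V → Set
  Apart (just x) (just y) = ¬ (x ~ y) × x ≢ y
  Apart _ _ = ⊤

  module _ {end : Rung → ℕ} {π₁ π₂ : Rung} where
    link-direct : ∀ {m} → Link end π₁ π₂ m → m ≡ nothing → rung π₁ (end π₁) ~ rung π₂ (end π₂)
    link-direct (direct a) refl = a

    adjacent⇒direct : ∀ {m} → Link end π₁ π₂ m → rung π₁ (end π₁) ~ rung π₂ (end π₂) → m ≡ nothing
    adjacent⇒direct (direct _) _ = refl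
    adjacent⇒direct (through na _ _) a = ⊥-elim (na a)

    attached₁ : ∀ {m z} → Link end π₁ π₂ m → m ≡ just z → Attached z π₁ (end π₁)
    attached₁ (through _ a _) refl = a

    attached₂ : ∀ {m z} → Link end π₁ π₂ m → m ≡ just z → Attached z π₂ (end π₂)
    attached₂ (through _ _ a) refl = a

  apart : ∀ {tp bt x y} → Apart tp bt → tp ≡ just x → bt ≡ just y → ¬ (x ~ y) × x ≢ y
  apart ap refl refl = ap

  record PairLinks (π₁ π₂ : Rung) : Set where
    field
      {bt tp} : Maybe V
      bottom-link : Link bottom π₁ π₂ bt
      top-link : Link top π₁ π₂ tp
      tp-bt-apart : Apart tp bt

  module Canonical {π₁ π₂ : Rung} (π₁≢π₂ : π₁ ≢ π₂) (links : PairLinks π₁ π₂) where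
    open PairLinks links
    T₁ T₂ : ℕ
    T₁ = top π₁
    T₂ = top π₂

    X D : InducedPath
    X = rungPath π₁
    D = reversePath (rungPath π₂)

    ends-meet : ∀ {s t} → s < suc T₁ → t < suc T₂ → rung π₁ s ~ rung π₂ (T₂ ∸ t) →
      (tp ≡ nothing × suc s ≡ suc T₁ × t ≡ 0) ⊎ (bt ≡ nothing × s ≡ 0 × suc t ≡ suc T₂)
    ends-meet {s} {t} s< t< a with rungs-meet-at-ends π₁≢π₂ (s≤s⁻¹ s<) (m∸n≤m T₂ t) a
    ... | inj₁ (s≡0 , e) = inj₂ ( adjacent⇒direct bottom-link (subst₂ (λ x y → rung π₁ x ~ rung π₂ y) s≡0 e a)
                                , s≡0 , cong suc (∸-cancelˡ-≡ (s≤s⁻¹ t<) ≤-refl (trans e (sym (n∸n≡0 T₂)))))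
    ... | inj₂ (s≡T , e) = inj₁ ( adjacent⇒direct top-link (subst₂ (λ x y → rung π₁ x ~ rung π₂ y) s≡T e a)
                                , cong suc s≡T , ∸-cancelˡ-≡ (s≤s⁻¹ t<) z≤n e)

    D-last : ∀ {t} → suc t ≡ suc T₂ → rung π₂ (T₂ ∸ t) ≡ rung π₂ 0
    D-last e = cong (rung π₂) (trans (cong (T₂ ∸_) (suc-injective e)) (n∸n≡0 T₂))

    gluing : GluingData X D tp bt
    gluing = record
      { X-nonempty = s≤s z≤n
      ; D-nonempty = s≤s z≤n
      ; long = ≤-trans (s≤s (s≤s (s≤s (s≤s z≤n)))) (+-mono-≤ (s≤s (top≥2 π₁)) (s≤s (top≥2 π₂)))
      ; X≢D = λ _ _ e → π₁≢π₂ (rung-injective e)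
      ; X~D-at-direct-ends = λ _ _ → ends-meet
      ; top∉X = λ ex s _ → Attached.off-rung (attached₁ top-link ex) s
      ; top∉D = λ ex t _ → Attached.off-rung (attached₂ top-link ex) (T₂ ∸ t)
      ; top~X-only-last = λ ex s s< a → cong suc (Attached.touches-only (attached₁ top-link ex) (s≤s⁻¹ s<) a)
      ; top~D-only-first = λ ex t t< a →
          ∸-cancelˡ-≡ (s≤s⁻¹ t<) z≤n (Attached.touches-only (attached₂ top-link ex) (m∸n≤m T₂ t) a)
      ; bottom∉X = λ ey s _ → Attached.off-rung (attached₁ bottom-link ey) s
      ; bottom∉D = λ ey t _ → Attached.off-rung (attached₂ bottom-link ey) (T₂ ∸ t)
      ; bottom~X-only-first = λ ey s s< a → Attached.touches-only (attached₁ bottom-link ey) (s≤s⁻¹ s<) a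
      ; bottom~D-only-last = λ ey t t< a → cong suc (∸-cancelˡ-≡ (s≤s⁻¹ t<) ≤-refl
          (trans (Attached.touches-only (attached₂ bottom-link ey) (m∸n≤m T₂ t) a) (sym (n∸n≡0 T₂))))
      ; top-bottom-apart = apart tp-bt-apart
      ; X-last~D-first = λ en s e → subst (λ x → rung π₁ x ~ rung π₂ T₂) (sym (suc-injective e)) (link-direct top-link en)
      ; X-last~top = λ ex s e → subst (λ x → rung π₁ x ~ _) (sym (suc-injective e)) (Attached.touches (attached₁ top-link ex))
      ; top~D-first = λ ex → ~-sym (Attached.touches (attached₂ top-link ex))
      ; D-last~X-first = λ en t e → subst (_~ rung π₁ 0) (sym (D-last e)) (~-sym (link-direct bottom-link en))
      ; D-last~bottom = λ ey t e → subst (_~ _) (sym (D-last e)) (Attached.touches (attached₂ bottom-link ey))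
      ; bottom~X-first = λ ey → ~-sym (Attached.touches (attached₁ bottom-link ey))
      }

    open Glue X D tp bt gluing public using (hole; top∈hole; bottom∈hole)
    open Glue X D tp bt gluing using (X⊆hole; D⊆hole)

    rung₁⊆hole : ∀ {q} → q ≤ T₁ → rung π₁ q ∈H hole
    rung₁⊆hole {q} q≤ = X⊆hole q (s≤s q≤)

    rung₂⊆hole : ∀ {q} → q ≤ T₂ → rung π₂ q ∈H hole
    rung₂⊆hole {q} q≤ = subst (_∈H hole) (cong (rung π₂) (m∸[m∸n]≡n q≤)) (D⊆hole (T₂ ∸ q) (s≤s (m∸n≤m T₂ q)))

  top≢0 : ∀ π → top π ≢ 0
  top≢0 π e = ¬2≤0 (subst (2 ≤_) e (top≥2 π))
    where
    ¬2≤0 : ¬ (2 ≤ 0)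
    ¬2≤0 ()

  bottom-attached : ∀ {π π′} → π′ ≢ π → rung π 0 ~ rung π′ 0 → Attached (rung π′ 0) π 0
  bottom-attached {π} {π′} ne a = record
    { touches = a
    ; touches-only = λ s≤ b → only (rungs-meet-at-ends ne z≤n s≤ b)
    ; off-rung = λ s e → ne (rung-injective e) }
    where
    only : ∀ {s} → (0 ≡ 0 × s ≡ 0) ⊎ (0 ≡ top π′ × s ≡ top π) → s ≡ 0
    only (inj₁ (_ , e)) = e
    only (inj₂ (e , _)) = ⊥-elim (top≢0 π′ (sym e))

  top-attached : ∀ {π π′} → π′ ≢ π → rung π (top π) ~ rung π′ (top π′) → Attached (rung π′ (top π′)) π (top π)
  top-attached {π} {π′} ne a = record
    { touches = a
    ; touches-only = λ s≤ b → only (rungs-meet-at-ends ne ≤-refl s≤ b)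
    ; off-rung = λ s e → ne (rung-injective e) }
    where
    only : ∀ {s} → (top π′ ≡ 0 × s ≡ 0) ⊎ (top π′ ≡ top π′ × s ≡ top π) → s ≡ top π
    only (inj₁ (e , _)) = ⊥-elim (top≢0 π′ e)
    only (inj₂ (_ , e)) = e

  rung-positions-differ : ∀ π {s t} → s ≤ top π → t ≤ top π → s ≢ t → rung π s ≢ rung π t
  rung-positions-differ π s≤ t≤ ne e = ne (rung-position-injective s≤ t≤ e)

  AvoidsStart : Rung → V → Set
  AvoidsStart π v = ∀ {p} → p ≤ 2 → v ≢ rung π p

  off-rung⇒avoidsStart : ∀ {π v} → (∀ p → v ≢ rung π p) → AvoidsStart π v
  off-rung⇒avoidsStart off {p} _ = off p

  closeOfSharedRungStart : ∀ (C D : Hole G) π {v} → AvoidsStart π v →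
    (∀ {p} → p ≤ 2 → rung π p ∈H C) → v ∈H C → (∀ {p} → p ≤ 2 → rung π p ∈H D) → v ∈H D → Close C D
  closeOfSharedRungStart C D π {v} v∉ C∋ v∈C D∋ v∈D =
    closeOfFourShared C D (rung π 0) (rung π 1) (rung π 2) v
      (rung-positions-differ π z≤n 1≤ (λ ())) (rung-positions-differ π z≤n 2≤ (λ ())) (λ e → v∉ z≤n (sym e))
      (rung-positions-differ π 1≤ 2≤ (λ ())) (λ e → v∉ (s≤s z≤n) (sym e)) (λ e → v∉ ≤-refl (sym e))
      (C∋ z≤n) (C∋ (s≤s z≤n)) (C∋ ≤-refl) v∈C (D∋ z≤n) (D∋ (s≤s z≤n)) (D∋ ≤-refl) v∈D
    where
    2≤ : 2 ≤ top π
    2≤ = top≥2 π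
    1≤ : 1 ≤ top π
    1≤ = ≤-trans (s≤s z≤n) 2≤

  closeOfTwoRungEdges : ∀ (C H : Hole G) (e : TwoRungEdges C) → let open TwoRungEdges e in
    (∀ {q} → q ≤ top π₁ → rung π₁ q ∈H H) → (∀ {q} → q ≤ top π₂ → rung π₂ q ∈H H) → Close C H
  closeOfTwoRungEdges C H e H∋₁ H∋₂ =
    closeOfFourShared C H (rung π₁ p₁) (rung π₁ (suc p₁)) (rung π₂ p₂) (rung π₂ (suc p₂))
      (rung-positions-differ π₁ (<⇒≤ p₁<) p₁< (n≢1+n p₁)) (other-rung π₁≢π₂) (other-rung π₁≢π₂)
      (other-rung π₁≢π₂) (other-rung π₁≢π₂) (rung-positions-differ π₂ (<⇒≤ p₂<) p₂< (n≢1+n p₂))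
      lo₁∈ hi₁∈ lo₂∈ hi₂∈ (H∋₁ (<⇒≤ p₁<)) (H∋₁ p₁<) (H∋₂ (<⇒≤ p₂<)) (H∋₂ p₂<)
    where
    open TwoRungEdges e
    n≢1+n : ∀ n → n ≢ suc n
    n≢1+n n e = 1+n≢n (sym e)
    other-rung : ∀ {π π′ s t} → π ≢ π′ → rung π s ≢ rung π′ t
    other-rung ne e = ne (rung-injective e)

  module EndCograph (λ₀ : ℕ) (end : Rung → ℕ) (B : Rung → Rung → Bool)
    (noP4 : NoInducedP4 B) (noC4 : NoInducedC4 B) (label : V → Maybe Rung)
    (labelled-at-end : ∀ {v π} → level v ≡ λ₀ → label v ≡ just π → v ≡ rung π (end π))
    (unlabelled-unique : ∀ {u v} → level u ≡ λ₀ → level v ≡ λ₀ → label u ≡ nothing → label v ≡ nothing → u ≡ v)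
    (unlabelled-universal : ∀ {u π} → level u ≡ λ₀ → label u ≡ nothing → u ~ rung π (end π))
    (B-sound : ∀ {π π′} → B π π′ ≡ true → rung π (end π) ~ rung π′ (end π′))
    (B-complete : ∀ {π π′} → rung π (end π) ~ rung π′ (end π′) → B π π′ ≡ true) where

    AtLevel : V → Set
    AtLevel v = level v ≡ λ₀

    label-injective : ∀ {u v} → AtLevel u → AtLevel v → label u ≡ label v → u ≡ v
    label-injective {u} hu hv e with label u in eu
    ... | just π = trans (labelled-at-end hu eu) (sym (labelled-at-end hv (sym e)))
    ... | nothing = unlabelled-unique hu hv eu (sym e)

    noHoleAtLevel : ∀ C → (∀ t → level (Hole.vtx C t) ≡ λ₀) → ⊥
    noHoleAtLevel = NoHoleInCograph.noHoleWithin SG B noP4 noC4 AtLevel label label-injective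
      (λ hu hv a iu iv → B-complete (subst₂ _~_ (labelled-at-end hu iu) (labelled-at-end hv iv) a))
      (λ hu hv b iu iv → subst₂ _~_ (sym (labelled-at-end hu iu)) (sym (labelled-at-end hv iv)) (B-sound b))
      (λ {u} hu hv iu iv → subst (u ~_) (sym (labelled-at-end hv iv)) (unlabelled-universal hu iu))

  record RungPairHoles : Set where
    field
      hole : ∀ {π₁ π₂} → π₁ ≢ π₂ → Hole G
      rung₁⊆ : ∀ {π₁ π₂} (ne : π₁ ≢ π₂) {q} → q ≤ top π₁ → rung π₁ q ∈H hole ne
      rung₂⊆ : ∀ {π₁ π₂} (ne : π₁ ≢ π₂) {q} → q ≤ top π₂ → rung π₂ q ∈H hole ne

  module _ (links : ∀ {π₁ π₂} → π₁ ≢ π₂ → PairLinks π₁ π₂) where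
    canonicalHoles : RungPairHoles
    canonicalHoles = record
      { hole = λ ne → Canonical.hole ne (links ne)
      ; rung₁⊆ = λ ne → Canonical.rung₁⊆hole ne (links ne)
      ; rung₂⊆ = λ ne → Canonical.rung₂⊆hole ne (links ne) }

  -- Every rung-pair hole is linked to the hub hole through w in at most two
  -- steps: first along rung π₁ of the hole to the hole through π₁ and w, then
  -- along rung w.
  record Hub (ℋ : RungPairHoles) : Set where
    open RungPairHoles ℋ
    field
      w w′ : Rung
      w≢w′ : w ≢ w′
      shared-from : ∀ {j} (ne : w ≢ j) → Σ V λ v → AvoidsStart w v × v ∈H hole ne × v ∈H hole w≢w′
      shared-to : ∀ {i} (ne : i ≢ w) → Σ V λ v → AvoidsStart w v × v ∈H hole ne × v ∈H hole w≢w′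
      bridge : ∀ {i j} (ne : i ≢ j) (i≢w : i ≢ w) → Σ V λ v → AvoidsStart i v × v ∈H hole ne × v ∈H hole i≢w

  module _ (ℋ : RungPairHoles) (hub : Hub ℋ) where
    open RungPairHoles ℋ
    open Hub hub

    start⊆ : ∀ {π₁ π₂} (ne : π₁ ≢ π₂) {p} → p ≤ 2 → rung π₁ p ∈H hole ne
    start⊆ {π₁} ne p≤ = rung₁⊆ ne (≤-trans p≤ (top≥2 π₁))

    start⊆₂ : ∀ {π₁ π₂} (ne : π₁ ≢ π₂) {p} → p ≤ 2 → rung π₂ p ∈H hole ne
    start⊆₂ {π₂ = π₂} ne p≤ = rung₂⊆ ne (≤-trans p≤ (top≥2 π₂))

    toHub : ∀ {i j} (ne : i ≢ j) → Equivalent (hole ne) (hole w≢w′)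
    toHub {i} ne with i ≟ʳ w
    ... | yes refl = let (v , v∉ , v∈ , v∈R) = shared-from ne in
          closeOfSharedRungStart (hole ne) (hole w≢w′) w v∉ (start⊆ ne) v∈ (start⊆ w≢w′) v∈R ◅ ε
    ... | no i≢w = let (v , v∉ , v∈ , v∈′) = bridge ne i≢w
                       (u , u∉ , u∈ , u∈R) = shared-to i≢w in
          _◅_ {j = hole i≢w} (closeOfSharedRungStart (hole ne) (hole i≢w) i v∉ (start⊆ ne) v∈ (start⊆ i≢w) v∈′)
            (closeOfSharedRungStart (hole i≢w) (hole w≢w′) w u∉ (start⊆₂ i≢w) u∈ (start⊆ w≢w′) u∈R ◅ ε)

    ladderAllHolesEquivalent : (∀ C → LevelConstant C → ⊥) → AllHolesEquivalent G
    ladderAllHolesEquivalent noLevelHole = allEquivalentViaHub (hole w≢w′) toR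
      where
      toR : ∀ C → Equivalent C (hole w≢w′)
      toR C with twoRungEdgesOrLevelConstant C
      ... | inj₂ flat = ⊥-elim (noLevelHole C flat)
      ... | inj₁ e = closeOfTwoRungEdges C (hole ne) e (rung₁⊆ ne) (rung₂⊆ ne) ◅ toHub ne
        where
        ne : TwoRungEdges.π₁ e ≢ TwoRungEdges.π₂ e
        ne = TwoRungEdges.π₁≢π₂ e

clamp : (L : ℕ) → ℕ → Fin (suc L)
clamp L zero = fz
clamp zero (suc p) = fz
clamp (suc L) (suc p) = fs (clamp L p)

toℕ-clamp : ∀ L {p} → p ≤ L → toℕ (clamp L p) ≡ p
toℕ-clamp L {zero} _ = refl
toℕ-clamp (suc L) {suc p} (s≤s le) = cong suc (toℕ-clamp L le)

clamp-toℕ : ∀ L (x : Fin (suc L)) → clamp L (toℕ x) ≡ x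
clamp-toℕ L fz = refl
clamp-toℕ (suc L) (fs x) = cong fs (clamp-toℕ L x)

toℕ≤ : ∀ {L} (x : Fin (suc L)) → toℕ x ≤ L
toℕ≤ x = s≤s⁻¹ (toℕ<n x)

true≢false : ∀ {b} → b ≡ true → b ≢ false
true≢false refl ()

not-true : ∀ {b} → not b ≡ true → b ≡ false
not-true {false} _ = refl

not-false : ∀ {b} → b ≡ false → not b ≡ true
not-false refl = refl

bool-cases : ∀ b → (b ≡ true) ⊎ (b ≡ false)
bool-cases true = inj₁ refl
bool-cases false = inj₂ refl

-- Threshold graphs

module _ {k : ℕ} (A : BGraph k) where

  Compl-irrefl : ∀ i → Compl A i i ≡ false
  Compl-irrefl i with i ≟ i
  ... | yes _ = refl
  ... | no ne = ⊥-elim (ne refl)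

  Compl-true : ∀ {i j} → Compl A i j ≡ true → i ≢ j × A i j ≡ false
  Compl-true {i} {j} e with i ≟ j
  ... | yes _ = ⊥-elim (true≢false e refl)
  ... | no ne = ne , not-true e

  Compl-intro : ∀ {i j} → i ≢ j → A i j ≡ false → Compl A i j ≡ true
  Compl-intro {i} {j} ne e with i ≟ j
  ... | yes eq = ⊥-elim (ne eq)
  ... | no _ = not-false e

  Compl-sym : (∀ i j → A i j ≡ A j i) → ∀ i j → Compl A i j ≡ Compl A j i
  Compl-sym A-sym i j with i ≟ j | j ≟ i
  ... | yes _ | yes _ = refl
  ... | no _ | no _ = cong not (A-sym i j)
  ... | yes e | no n = ⊥-elim (n (sym e))
  ... | no n | yes e = ⊥-elim (n (sym e))

  threshold-noP4 : Threshold A → NoInducedP4 A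
  threshold-noP4 thr {a} {b} {c} {d} d4 e₁ e₂ e₃ n₁ n₂ n₃ = proj₁ (thr a b c d d4) (e₁ , e₂ , e₃ , n₁ , n₂ , n₃)

  threshold-noC4 : Threshold A → NoInducedC4 A
  threshold-noC4 thr {a} {b} {c} {d} d4 e₁ e₂ e₃ e₄ n₁ n₂ = proj₁ (proj₂ (thr a b c d d4)) (e₁ , e₂ , e₃ , e₄ , n₁ , n₂)

  -- Without induced P4 and 2K2, two vertices that both have neighbours are at
  -- distance at most 2.
  connected-without-isolated : IsSimple A → Threshold A → (∀ u → Σ (Fin k) λ x → A u x ≡ true) → Connected A
  connected-without-isolated (A-sym , A-irr) thr nbr u v with u ≟ v
  ... | yes refl = ε
  ... | no u≢v with bool-cases (A u v)
  ...   | inj₁ uv = uv ◅ ε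
  ...   | inj₂ ¬uv with nbr u
  ...     | x , ux with bool-cases (A x v)
  ...       | inj₁ xv = ux ◅ xv ◅ ε
  ...       | inj₂ ¬xv with nbr v
  ...         | y , vy with bool-cases (A u y)
  ...           | inj₁ uy = uy ◅ trans (A-sym y v) vy ◅ ε
  ...           | inj₂ ¬uy = ⊥-elim (P4-or-2K2 (bool-cases (A x y)))
    where
    yv : A y v ≡ true
    yv = trans (A-sym y v) vy
    d4 : Distinct4 A u x y v
    d4 = (λ { refl → true≢false ux (A-irr u) }) , (λ { refl → true≢false (trans (A-sym u v) vy) ¬uv }) , u≢v
       , (λ { refl → true≢false yv ¬xv }) , (λ { refl → true≢false ux ¬uv }) , (λ { refl → true≢false vy (A-irr v) })
    P4-or-2K2 : (A x y ≡ true) ⊎ (A x y ≡ false) → ⊥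
    P4-or-2K2 (inj₁ xy) = proj₁ (thr u x y v d4) (ux , xy , yv , ¬uy , ¬xv , ¬uv)
    P4-or-2K2 (inj₂ ¬xy) = proj₂ (proj₂ (thr u x y v d4)) (ux , yv , ¬uy , ¬uv , ¬xy , ¬xv)

  isolated-of-disconnected : IsSimple A → Threshold A → Disconnected A → Σ (Fin k) λ w → ∀ x → A w x ≡ false
  isolated-of-disconnected simple thr disconnected
    with any? (λ w → all? (λ x → A w x Data.Bool.≟ false))
  ... | yes isolated = isolated
  ... | no none = ⊥-elim (disconnected (connected-without-isolated simple thr neighbour))
    where
    neighbour : ∀ u → Σ (Fin k) λ x → A u x ≡ true
    neighbour u with ¬∀⟶∃¬ k _ (λ x → A u x Data.Bool.≟ false) (λ all → none (u , all))
    ... | x , ¬ux with bool-cases (A u x)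
    ...   | inj₁ ux = x , ux
    ...   | inj₂ e = ⊥-elim (¬ux e)

another : ∀ {k} → 2 ≤ k → (w : Fin k) → Σ (Fin k) (w ≢_)
another {suc (suc k)} _ fz = fs fz , λ ()
another {suc (suc k)} _ (fs w) = fz , λ ()
another {suc zero} (s≤s ()) _

two-distinct : ∀ {k} → 2 ≤ k → Σ (Fin k) λ i → Σ (Fin k) λ i′ → i ≢ i′
two-distinct {suc (suc k)} _ = fz , fs fz , λ ()
two-distinct {suc zero} (s≤s ())

-- Odd frames

module OddFrameHoles {ℓ : ℕ} (F : OddFrame ℓ) (L≥2 : 2 ≤ oddLen ℓ) where
  open OddFrame F
  open Graph (oddApexedGraph F)

  L : ℕ
  L = oddLen ℓ

  G : Graph
  G = oddApexedGraph F

  apex : V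
  apex = inj₂ tt

  apexLevel : ℕ
  apexLevel = if apexOnA then 0 else L

  A-sym : ∀ i j → A i j ≡ A j i
  A-sym = proj₁ A-simple

  A-irr : ∀ i → A i i ≡ false
  A-irr = proj₂ A-simple

  L≢0 : L ≢ 0
  L≢0 e = ¬2≤0 (subst (2 ≤_) e L≥2)
    where
    ¬2≤0 : ¬ (2 ≤ 0)
    ¬2≤0 ()

  toℕ-clampL : toℕ (clamp L L) ≡ L
  toℕ-clampL = toℕ-clamp L ≤-refl

  data RungEdge (i : Fin k) (p : Fin (suc L)) (j : Fin k) (q : Fin (suc L)) : Set where
    along : i ≡ j → (suc (toℕ p) ≡ toℕ q) ⊎ (suc (toℕ q) ≡ toℕ p) → RungEdge i p j q
    at-bottom : toℕ p ≡ 0 → toℕ q ≡ 0 → A i j ≡ true → RungEdge i p j q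
    at-top : toℕ p ≡ L → toℕ q ≡ L → Compl A i j ≡ true → RungEdge i p j q

  rungEdge : ∀ {i p j q} → inj₁ (i , p) ~ inj₁ (j , q) → RungEdge i p j q
  rungEdge (inj₁ (inj₁ (e , s))) = along e (inj₁ s)
  rungEdge (inj₁ (inj₂ (inj₁ (x , y , c)))) = at-bottom x y c
  rungEdge (inj₁ (inj₂ (inj₂ (x , y , c)))) = at-top x y c
  rungEdge (inj₂ (inj₁ (e , s))) = along (sym e) (inj₂ s)
  rungEdge {i} {j = j} (inj₂ (inj₂ (inj₁ (x , y , c)))) = at-bottom y x (trans (A-sym i j) c)
  rungEdge {i} {j = j} (inj₂ (inj₂ (inj₂ (x , y , c)))) = at-top y x (trans (Compl-sym A A-sym i j) c)

  apexEdge : ∀ {i p} → inj₁ (i , p) ~ apex → toℕ p ≡ apexLevel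
  apexEdge {p = p} (inj₁ r) = unfold apexOnA r
    where
    unfold : ∀ b → (if b then toℕ p ≡ 0 else toℕ p ≡ L) → toℕ p ≡ (if b then 0 else L)
    unfold true e = e
    unfold false e = e

  toApex : ∀ {i p} → toℕ p ≡ apexLevel → inj₁ (i , p) ~ apex
  toApex {p = p} e = inj₁ (fold apexOnA e)
    where
    fold : ∀ b → toℕ p ≡ (if b then 0 else L) → (if b then toℕ p ≡ 0 else toℕ p ≡ L)
    fold true e = e
    fold false e = e

  ¬apex~apex : ¬ (apex ~ apex)
  ¬apex~apex (inj₁ ())
  ¬apex~apex (inj₂ ())

  simple : SimpleGraph G
  simple = record { ~-sym = λ { (inj₁ r) → inj₂ r ; (inj₂ r) → inj₁ r } ; ~-irrefl = λ {u} → irrefl {u} }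
    where
    irrefl : ∀ {u} → ¬ (u ~ u)
    irrefl {inj₁ (i , p)} a with rungEdge a
    ... | along _ (inj₁ s) = 1+n≢n s
    ... | along _ (inj₂ s) = 1+n≢n s
    ... | at-bottom _ _ c = true≢false c (A-irr i)
    ... | at-top _ _ c = true≢false c (Compl-irrefl A i)
    irrefl {inj₂ tt} a = ¬apex~apex a

  open SimpleGraph simple

  rung : Fin k → ℕ → V
  rung i p = inj₁ (i , clamp L p)

  level : V → ℕ
  level (inj₁ (_ , p)) = toℕ p
  level (inj₂ _) = apexLevel

  label : V → Maybe (Fin k)
  label (inj₁ (i , _)) = just i
  label (inj₂ _) = nothing

  rung-adjacent : ∀ i {s} → s < L → rung i s ~ rung i (suc s)
  rung-adjacent i {s} s< = inj₁ (inj₁ (refl , trans (cong suc (toℕ-clamp L (<⇒≤ s<))) (sym (toℕ-clamp L s<))))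

  rung-induced : ∀ i {s t} → s ≤ L → t ≤ L → rung i s ~ rung i t → (suc s ≡ t) ⊎ (suc t ≡ s)
  rung-induced i {s} {t} s≤ t≤ a with rungEdge a
  ... | along _ (inj₁ e) = inj₁ (trans (cong suc (sym (toℕ-clamp L s≤))) (trans e (toℕ-clamp L t≤)))
  ... | along _ (inj₂ e) = inj₂ (trans (cong suc (sym (toℕ-clamp L t≤))) (trans e (toℕ-clamp L s≤)))
  ... | at-bottom _ _ c = ⊥-elim (true≢false c (A-irr i))
  ... | at-top _ _ c = ⊥-elim (true≢false c (Compl-irrefl A i))

  rungs-meet-at-ends : ∀ {i j s t} → i ≢ j → s ≤ L → t ≤ L → rung i s ~ rung j t → (s ≡ 0 × t ≡ 0) ⊎ (s ≡ L × t ≡ L)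
  rungs-meet-at-ends ne s≤ t≤ a with rungEdge a
  ... | along e _ = ⊥-elim (ne e)
  ... | at-bottom x y _ = inj₁ (trans (sym (toℕ-clamp L s≤)) x , trans (sym (toℕ-clamp L t≤)) y)
  ... | at-top x y _ = inj₂ (trans (sym (toℕ-clamp L s≤)) x , trans (sym (toℕ-clamp L t≤)) y)

  consecutive : ∀ i (p q : Fin (suc L)) → suc (toℕ p) ≡ toℕ q → RungStep (λ _ → L) rung (inj₁ (i , p)) (inj₁ (i , q))
  consecutive i p q s = i , toℕ p , ≤-trans (≤-reflexive s) (toℕ≤ q)
    , cong (λ x → inj₁ (i , x)) (sym (clamp-toℕ L p))
    , cong (λ x → inj₁ (i , x)) (sym (trans (cong (clamp L) s) (clamp-toℕ L q)))

  rung-step-or-flat : ∀ {u v} → u ~ v →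
    RungStep (λ _ → L) rung u v ⊎ RungStep (λ _ → L) rung v u ⊎ level u ≡ level v
  rung-step-or-flat {inj₁ (i , p)} {inj₁ (j , q)} a with rungEdge a
  ... | along refl (inj₁ s) = inj₁ (consecutive i p q s)
  ... | along refl (inj₂ s) = inj₂ (inj₁ (consecutive i q p s))
  ... | at-bottom x y _ = inj₂ (inj₂ (trans x (sym y)))
  ... | at-top x y _ = inj₂ (inj₂ (trans x (sym y)))
  rung-step-or-flat {inj₁ (i , p)} {inj₂ tt} a = inj₂ (inj₂ (apexEdge {i} {p} a))
  rung-step-or-flat {inj₂ tt} {inj₁ (j , q)} a = inj₂ (inj₂ (sym (apexEdge {j} {q} (~-sym {inj₂ tt} {inj₁ (j , q)} a))))
  rung-step-or-flat {inj₂ tt} {inj₂ tt} a = ⊥-elim (¬apex~apex a)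

  ladder : Ladder G
  ladder = record
    { Rung = Fin k ; _≟ʳ_ = _≟_ ; top = λ _ → L ; rung = rung ; level = level
    ; top≥2 = λ _ → L≥2
    ; rung-position-injective = λ s≤ t≤ e → trans (sym (toℕ-clamp L s≤)) (trans (cong level e) (toℕ-clamp L t≤))
    ; rung-injective = λ e → just-injective (cong label e)
    ; rung-adjacent = rung-adjacent
    ; rung-induced = rung-induced
    ; rungs-meet-at-ends = rungs-meet-at-ends
    ; level-mono = λ _ {p} {q} p≤q q≤ →
        subst₂ _≤_ (sym (toℕ-clamp L (≤-trans p≤q q≤))) (sym (toℕ-clamp L q≤)) p≤q
    ; rung-step-or-flat = rung-step-or-flat }

  open LadderCuts simple ladder using (LevelConstant)
  open LadderHoles simple ladder

  bottom-sound : ∀ {i j} → A i j ≡ true → rung i 0 ~ rung j 0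
  bottom-sound c = inj₁ (inj₂ (inj₁ (refl , refl , c)))

  bottom-complete : ∀ {i j} → rung i 0 ~ rung j 0 → A i j ≡ true
  bottom-complete a with rungEdge a
  ... | along _ (inj₁ ())
  ... | along _ (inj₂ ())
  ... | at-bottom _ _ c = c
  ... | at-top x _ _ = ⊥-elim (L≢0 (sym x))

  top-sound : ∀ {i j} → Compl A i j ≡ true → rung i L ~ rung j L
  top-sound c = inj₁ (inj₂ (inj₂ (toℕ-clampL , toℕ-clampL , c)))

  top-complete : ∀ {i j} → rung i L ~ rung j L → Compl A i j ≡ true
  top-complete a with rungEdge a
  ... | along _ (inj₁ s) = ⊥-elim (1+n≢n s)
  ... | along _ (inj₂ s) = ⊥-elim (1+n≢n s)
  ... | at-bottom x _ _ = ⊥-elim (L≢0 (trans (sym toℕ-clampL) x))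
  ... | at-top _ _ c = c

  apexLevel-at-end : (apexLevel ≡ 0) ⊎ (apexLevel ≡ L)
  apexLevel-at-end with apexOnA
  ... | true = inj₁ refl
  ... | false = inj₂ refl

  flat-edge-at-end : ∀ {u v} → u ~ v → level u ≡ level v → (level u ≡ 0) ⊎ (level u ≡ L)
  flat-edge-at-end {inj₁ (i , p)} {inj₁ (j , q)} a e with rungEdge a
  ... | along _ (inj₁ s) = ⊥-elim (1+n≢n (trans s (sym e)))
  ... | along _ (inj₂ s) = ⊥-elim (1+n≢n (trans s e))
  ... | at-bottom x _ _ = inj₁ x
  ... | at-top x _ _ = inj₂ x
  flat-edge-at-end {inj₁ _} {inj₂ tt} _ e with apexLevel-at-end
  ... | inj₁ z = inj₁ (trans e z)
  ... | inj₂ z = inj₂ (trans e z)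
  flat-edge-at-end {inj₂ tt} _ _ = apexLevel-at-end

  labelled-at : ∀ {v i e} → e ≤ L → level v ≡ e → label v ≡ just i → v ≡ rung i e
  labelled-at {inj₁ (i , p)} e≤ hv refl = cong (λ x → inj₁ (i , x)) (toℕ-injective (trans hv (sym (toℕ-clamp L e≤))))

  unlabelled-unique : ∀ {u v} → label u ≡ nothing → label v ≡ nothing → u ≡ v
  unlabelled-unique {inj₂ tt} {inj₂ tt} _ _ = refl

  apex~rung : ∀ {i e} → e ≤ L → apexLevel ≡ e → apex ~ rung i e
  apex~rung {i} {e} e≤ eq = ~-sym {rung i e} {apex} (toApex {i} {clamp L e} (trans (toℕ-clamp L e≤) (sym eq)))

  unlabelled-universal : ∀ {u i e} → e ≤ L → level u ≡ e → label u ≡ nothing → u ~ rung i e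
  unlabelled-universal {inj₂ tt} {i} e≤ hu _ = apex~rung {i} e≤ hu

  noLevelConstantHole : ∀ C → LevelConstant C → ⊥
  noLevelConstantHole C flat
    with flat-edge-at-end {Walk.walk C 0} {Walk.walk C 1} (FirstFour.adj01 C) (flat (Walk.at C 0) (Walk.at C 1))
  ... | inj₁ z = EndCograph.noHoleAtLevel 0 bottom A (threshold-noP4 A A-thr) (threshold-noC4 A A-thr) label
        (labelled-at z≤n) (λ _ _ → unlabelled-unique) (unlabelled-universal z≤n) bottom-sound bottom-complete
        C (λ t → trans (flat t (Walk.at C 0)) z)
  ... | inj₂ z = EndCograph.noHoleAtLevel L (λ _ → L) (Compl A) (threshold-noP4 (Compl A) B-thr)
        (threshold-noC4 (Compl A) B-thr) label
        (labelled-at ≤-refl) (λ _ _ → unlabelled-unique) (unlabelled-universal ≤-refl) top-sound top-complete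
        C (λ t → trans (flat t (Walk.at C 0)) z)

  -- A pair adjacent in A is joined by an edge at the bottom and through a
  -- joiner at the top; any other pair is joined at the top and through a
  -- joiner at the bottom.
  joinerEnd : Bool → ℕ
  joinerEnd true = L
  joinerEnd false = 0

  joinerEnd≤L : ∀ b → joinerEnd b ≤ L
  joinerEnd≤L true = ≤-refl
  joinerEnd≤L false = z≤n

  ¬bottom-edge : ∀ {i j} → A i j ≡ false → ¬ (rung i 0 ~ rung j 0)
  ¬bottom-edge c a = true≢false (bottom-complete a) c

  ¬top-edge : ∀ {i j} → A i j ≡ true → ¬ (rung i L ~ rung j L)
  ¬top-edge c a = true≢false c (proj₂ (Compl-true A (top-complete a)))

  top-edge : ∀ {i j} → i ≢ j → A i j ≡ false → rung i L ~ rung j L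
  top-edge ne c = top-sound (Compl-intro A ne c)

  apex-attached : ∀ {i e} → e ≤ L → e ≡ apexLevel → Attached apex i e
  apex-attached {i} {e} e≤ eq = record
    { touches = toApex {i} {clamp L e} (trans (toℕ-clamp L e≤) eq)
    ; touches-only = λ {s} s≤ a →
        trans (sym (toℕ-clamp L s≤)) (trans (apexEdge {i} {clamp L s} (~-sym {apex} {rung i s} a)) (sym eq))
    ; off-rung = λ _ () }

  apex-avoids : ∀ i → AvoidsStart i apex
  apex-avoids i _ ()

  module PairHoles (joiner : Bool → V)
    (joiner-attached : ∀ {i j b} → i ≢ j → A i j ≡ b → Attached (joiner b) i (joinerEnd b)) where

    linksAt : ∀ {i j} → i ≢ j → (b : Bool) → A i j ≡ b → PairLinks i j
    linksAt {i} {j} ne true e = record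
      { bottom-link = direct (bottom-sound e)
      ; top-link = through (¬top-edge e) (joiner-attached ne e) (joiner-attached (≢-sym ne) (trans (A-sym j i) e))
      ; tp-bt-apart = tt }
    linksAt {i} {j} ne false e = record
      { bottom-link = through (¬bottom-edge e) (joiner-attached ne e) (joiner-attached (≢-sym ne) (trans (A-sym j i) e))
      ; top-link = direct (top-edge ne e)
      ; tp-bt-apart = tt }

    holes : RungPairHoles
    holes = canonicalHoles (λ {i} {j} ne → linksAt ne (A i j) refl)

    open RungPairHoles holes

    joiner∈ : ∀ {i j} (ne : i ≢ j) → joiner (A i j) ∈H hole ne
    joiner∈ {i} {j} ne = at (A i j) refl
      where
      at : (b : Bool) (e : A i j ≡ b) → joiner b ∈H Canonical.hole ne (linksAt ne b e)
      at true e = Canonical.top∈hole ne (linksAt ne true e) refl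
      at false e = Canonical.bottom∈hole ne (linksAt ne false e) refl

    -- w is isolated in the graph (A or its complement) on the apex side, so
    -- every pair containing w is joined through the apex.
    module _ (w w′ : Fin k) (w≢w′ : w ≢ w′) (κ : Bool)
      (w-kind : ∀ {x} → w ≢ x → A w x ≡ κ) (apex-joins-w : joiner κ ≡ apex)
      (joiner-cases : ∀ b → joiner b ≡ apex ⊎ joiner b ≡ rung w (joinerEnd b)) where

      apex∈ : ∀ {i j} (ne : i ≢ j) → A i j ≡ κ → apex ∈H hole ne
      apex∈ ne e = subst (_∈H hole ne) (trans (cong joiner e) apex-joins-w) (joiner∈ ne)

      apex∈ʷ : ∀ {i} (ne : i ≢ w) → apex ∈H hole ne
      apex∈ʷ {i} ne = apex∈ ne (trans (A-sym i w) (w-kind (≢-sym ne)))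

      joiner∈ʷ : ∀ {i j} (ne : i ≢ j) (i≢w : i ≢ w) → joiner (A i j) ∈H hole i≢w
      joiner∈ʷ {i} {j} ne i≢w with joiner-cases (A i j)
      ... | inj₁ e = subst (_∈H hole i≢w) (sym e) (apex∈ʷ i≢w)
      ... | inj₂ e = subst (_∈H hole i≢w) (sym e) (rung₂⊆ i≢w (joinerEnd≤L (A i j)))

      hub : Hub holes
      hub = record
        { w = w ; w′ = w′ ; w≢w′ = w≢w′
        ; shared-from = λ ne → apex , apex-avoids w , apex∈ ne (w-kind ne) , apex∈ w≢w′ (w-kind w≢w′)
        ; shared-to = λ ne → apex , apex-avoids w , apex∈ʷ ne , apex∈ w≢w′ (w-kind w≢w′)
        ; bridge = λ ne i≢w → _ , off-rung⇒avoidsStart (Attached.off-rung (joiner-attached ne refl))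
                            , joiner∈ ne , joiner∈ʷ ne i≢w }

      allHolesEquivalent : AllHolesEquivalent G
      allHolesEquivalent = ladderAllHolesEquivalent holes hub noLevelConstantHole

  ApexSide : Bool → Set
  ApexSide b = if b then (Disconnected A × ¬ Disconnected (Compl A)) else (Disconnected (Compl A) × ¬ Disconnected A)

  k≥2 : 2 ≤ k
  k≥2 = ≤-trans (n≤1+n 2) k≥3

  apex-on-A : apexOnA ≡ true → AllHolesEquivalent G
  apex-on-A onA = PairHoles.allHolesEquivalent joiner joiner-attached w (proj₁ (another k≥2 w)) (proj₂ (another k≥2 w))
    false (λ {x} _ → isolated x) refl joiner-cases
    where
    isolated-w : Σ (Fin k) λ w → ∀ x → A w x ≡ false
    isolated-w = isolated-of-disconnected A A-simple A-thr (proj₁ (subst ApexSide onA exactlyOne))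
    w : Fin k
    w = proj₁ isolated-w
    isolated : ∀ x → A w x ≡ false
    isolated = proj₂ isolated-w
    joiner : Bool → V
    joiner true = rung w L
    joiner false = apex
    joiner-attached : ∀ {i j b} → i ≢ j → A i j ≡ b → Attached (joiner b) i (joinerEnd b)
    joiner-attached {i} {j} {true} _ e = top-attached w≢i (top-edge (≢-sym w≢i) (trans (A-sym i w) (isolated i)))
      where
      w≢i : w ≢ i
      w≢i refl = true≢false e (isolated j)
    joiner-attached {b = false} _ _ = apex-attached z≤n (sym (cong (λ b → if b then 0 else L) onA))
    joiner-cases : ∀ b → joiner b ≡ apex ⊎ joiner b ≡ rung w (joinerEnd b)
    joiner-cases true = inj₂ refl
    joiner-cases false = inj₁ refl

  apex-on-B : apexOnA ≡ false → AllHolesEquivalent G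
  apex-on-B onB = PairHoles.allHolesEquivalent joiner joiner-attached w (proj₁ (another k≥2 w)) (proj₂ (another k≥2 w))
    true adjacent refl joiner-cases
    where
    isolated-w : Σ (Fin k) λ w → ∀ x → Compl A w x ≡ false
    isolated-w = isolated-of-disconnected (Compl A) (Compl-sym A A-sym , Compl-irrefl A) B-thr
      (proj₁ (subst ApexSide onB exactlyOne))
    w : Fin k
    w = proj₁ isolated-w
    adjacent : ∀ {x} → w ≢ x → A w x ≡ true
    adjacent {x} ne with bool-cases (A w x)
    ... | inj₁ t = t
    ... | inj₂ f = ⊥-elim (true≢false (Compl-intro A ne f) (proj₂ isolated-w x))
    joiner : Bool → V
    joiner true = apex
    joiner false = rung w 0
    joiner-attached : ∀ {i j b} → i ≢ j → A i j ≡ b → Attached (joiner b) i (joinerEnd b)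
    joiner-attached {b = true} _ _ = apex-attached ≤-refl (sym (cong (λ b → if b then 0 else L) onB))
    joiner-attached {i} {j} {false} ne e = bottom-attached w≢i (bottom-sound (trans (A-sym i w) (adjacent w≢i)))
      where
      w≢i : w ≢ i
      w≢i refl = true≢false (adjacent ne) e
    joiner-cases : ∀ b → joiner b ≡ apex ⊎ joiner b ≡ rung w (joinerEnd b)
    joiner-cases true = inj₁ refl
    joiner-cases false = inj₂ refl

  oddAllHolesEquivalent : AllHolesEquivalent G
  oddAllHolesEquivalent with bool-cases apexOnA
  ... | inj₁ onA = apex-on-A onA
  ... | inj₂ onB = apex-on-B onB

-- Even frames

HalfGraph : {n m : ℕ} → (Fin n → Fin m → Bool) → Set
HalfGraph H = ∀ i i′ j j′ → ¬ (H i j ≡ true × H i′ j′ ≡ true × H i j′ ≡ false × H i′ j ≡ false)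

half-complement : ∀ {n m} {H : Fin n → Fin m → Bool} → HalfGraph H → HalfGraph (λ i j → not (H i j))
half-complement half i i′ j j′ (a , b , c , d) = half i i′ j′ j (not-false⁻¹ c , not-false⁻¹ d , not-true a , not-true b)
  where
  not-false⁻¹ : ∀ {x} → not x ≡ false → x ≡ true
  not-false⁻¹ {true} _ = refl

distinct : ∀ {m} (j j′ : Fin m) → Bool
distinct j j′ = not (does (j ≟ j′))

distinct-true : ∀ {m} {j j′ : Fin m} → j ≢ j′ → distinct j j′ ≡ true
distinct-true {j = j} {j′} ne with j ≟ j′
... | yes e = ⊥-elim (ne e)
... | no _ = refl

distinct-true-inv : ∀ {m} {j j′ : Fin m} → distinct j j′ ≡ true → j ≢ j′
distinct-true-inv {j = j} {j′} e eq with j ≟ j′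
... | yes _ = true≢false e refl
... | no ne = ne eq

-- A stable set Fin n and a clique Fin m, joined by the bipartite graph H.
splitGraph : {n m : ℕ} → (Fin n → Fin m → Bool) → Fin n ⊎ Fin m → Fin n ⊎ Fin m → Bool
splitGraph H (inj₁ _) (inj₁ _) = false
splitGraph H (inj₁ i) (inj₂ j) = H i j
splitGraph H (inj₂ j) (inj₁ i) = H i j
splitGraph H (inj₂ j) (inj₂ j′) = distinct j j′

module _ {n m : ℕ} {H : Fin n → Fin m → Bool} (half : HalfGraph H) where
  private
    V : Set
    V = Fin n ⊎ Fin m

    B : V → V → Bool
    B = splitGraph H

    clique : ∀ {j j′ : Fin m} → _≢_ {A = V} (inj₂ j) (inj₂ j′) → B (inj₂ j) (inj₂ j′) ≡ true
    clique ne = distinct-true (λ e → ne (cong inj₂ e))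

    -- Clique vertices are pairwise adjacent and stable ones pairwise
    -- non-adjacent, so a, d must be stable and b, c clique vertices; then ab, dc
    -- is an induced 2K2 of H.
    no-induced-P4-or-C4 : ∀ {a b c d : V} → a ≢ c → b ≢ d →
      B a b ≡ true → B b c ≡ true → B c d ≡ true → B a c ≡ false → B b d ≡ false → ⊥
    no-induced-P4-or-C4 {inj₁ _} {inj₁ _} _ _ () _ _ _ _
    no-induced-P4-or-C4 {inj₂ _} {inj₁ _} {inj₁ _} _ _ _ () _ _ _
    no-induced-P4-or-C4 {inj₁ _} {inj₂ _} {inj₁ _} {inj₁ _} _ _ _ _ () _ _
    no-induced-P4-or-C4 {inj₂ _} {inj₂ _} {inj₁ _} {inj₁ _} _ _ _ _ () _ _
    no-induced-P4-or-C4 {inj₂ _} {inj₁ _} {inj₂ _} ac _ _ _ _ nac _ = true≢false (clique ac) nac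
    no-induced-P4-or-C4 {inj₂ _} {inj₂ _} {inj₂ _} ac _ _ _ _ nac _ = true≢false (clique ac) nac
    no-induced-P4-or-C4 {inj₁ _} {inj₂ _} {inj₁ _} {inj₂ _} _ bd _ _ _ _ nbd = true≢false (clique bd) nbd
    no-induced-P4-or-C4 {inj₁ _} {inj₂ _} {inj₂ _} {inj₂ _} _ bd _ _ _ _ nbd = true≢false (clique bd) nbd
    no-induced-P4-or-C4 {inj₂ _} {inj₂ _} {inj₁ _} {inj₂ _} _ bd _ _ _ _ nbd = true≢false (clique bd) nbd
    no-induced-P4-or-C4 {inj₁ i} {inj₂ j} {inj₂ j′} {inj₁ i′} _ _ e₁ _ e₃ n₁ n₂ = half i i′ j j′ (e₁ , e₃ , n₁ , n₂)

  split-noP4 : NoInducedP4 B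
  split-noP4 (_ , ac , _ , _ , bd , _) e₁ e₂ e₃ n₁ n₂ _ = no-induced-P4-or-C4 ac bd e₁ e₂ e₃ n₁ n₂

  split-noC4 : NoInducedC4 B
  split-noC4 (_ , ac , _ , _ , bd , _) e₁ e₂ e₃ _ n₁ n₂ = no-induced-P4-or-C4 ac bd e₁ e₂ e₃ n₁ n₂

module EvenFrameHoles {ℓ : ℕ} (F : EvenFrame ℓ) (LP≥2 : 2 ≤ evenLenP ℓ) (LQ≡1+LP : evenLenQ ℓ ≡ suc (evenLenP ℓ)) where
  open EvenFrame F
  open Graph (evenApexedGraph F)

  LP LQ : ℕ
  LP = evenLenP ℓ
  LQ = evenLenQ ℓ

  G : Graph
  G = evenApexedGraph F

  LQ≥3 : 3 ≤ LQ
  LQ≥3 = subst (3 ≤_) (sym LQ≡1+LP) (s≤s LP≥2)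

  LQ≢0 : LQ ≢ 0
  LQ≢0 e = 1+n≢0 (trans (sym LQ≡1+LP) e)

  Rung : Set
  Rung = Fin n ⊎ Fin m

  top : Rung → ℕ
  top (inj₁ _) = LP
  top (inj₂ _) = LQ

  top≥2 : ∀ π → 2 ≤ top π
  top≥2 (inj₁ _) = LP≥2
  top≥2 (inj₂ _) = ≤-trans (n≤1+n 2) LQ≥3

  rung : Rung → ℕ → V
  rung (inj₁ i) p = pv i (clamp LP p)
  rung (inj₂ j) q = qv j (clamp LQ q)

  -- The top b_i of a P-rung sits at position LP but is given the level LQ of the d_j.
  lift : ℕ → ℕ
  lift p with p <? LP
  ... | yes _ = p
  ... | no _ = suc p

  lift-strict : ∀ {p q} → p < q → lift p < lift q
  lift-strict {p} {q} p<q with p <? LP | q <? LP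
  ... | yes _ | yes _ = p<q
  ... | yes _ | no _ = m<n⇒m<1+n p<q
  ... | no p≮ | yes q< = ⊥-elim (p≮ (<-trans p<q q<))
  ... | no _ | no _ = s≤s p<q

  lift-injective : ∀ {p q} → lift p ≡ lift q → p ≡ q
  lift-injective {p} {q} e with <-cmp p q
  ... | tri< p<q _ _ = ⊥-elim (<⇒≢ (lift-strict p<q) e)
  ... | tri≈ _ p≡q _ = p≡q
  ... | tri> _ _ q<p = ⊥-elim (<⇒≢ (lift-strict q<p) (sym e))

  lift-0 : lift 0 ≡ 0
  lift-0 with 0 <? LP
  ... | yes _ = refl
  ... | no 0≮ = ⊥-elim (0≮ (≤-trans (s≤s z≤n) LP≥2))

  lift-LP : lift LP ≡ LQ
  lift-LP with LP <? LP
  ... | yes LP< = ⊥-elim (<-irrefl refl LP<)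
  ... | no _ = sym LQ≡1+LP

  level : V → ℕ
  level (pv _ p) = lift (toℕ p)
  level (qv _ q) = toℕ q
  level a0 = 0
  level b0 = LQ

  levelOn : Rung → ℕ → ℕ
  levelOn (inj₁ _) = lift
  levelOn (inj₂ _) s = s

  levelOn-strict : ∀ π {s t} → s < t → levelOn π s < levelOn π t
  levelOn-strict (inj₁ _) = lift-strict
  levelOn-strict (inj₂ _) s<t = s<t

  levelOn-injective : ∀ π {s t} → levelOn π s ≡ levelOn π t → s ≡ t
  levelOn-injective (inj₁ _) = lift-injective
  levelOn-injective (inj₂ _) e = e

  levelOn-0 : ∀ π → levelOn π 0 ≡ 0
  levelOn-0 (inj₁ _) = lift-0
  levelOn-0 (inj₂ _) = refl

  levelOn-top : ∀ π → levelOn π (top π) ≡ LQ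
  levelOn-top (inj₁ _) = lift-LP
  levelOn-top (inj₂ _) = refl

  position : V → ℕ
  position (pv _ p) = toℕ p
  position (qv _ q) = toℕ q
  position a0 = 0
  position b0 = 0

  label : V → Maybe Rung
  label (pv i _) = just (inj₁ i)
  label (qv j _) = just (inj₂ j)
  label a0 = nothing
  label b0 = nothing

  position-rung : ∀ π {s} → s ≤ top π → position (rung π s) ≡ s
  position-rung (inj₁ _) = toℕ-clamp LP
  position-rung (inj₂ _) = toℕ-clamp LQ

  level-rung : ∀ π {s} → s ≤ top π → level (rung π s) ≡ levelOn π s
  level-rung (inj₁ _) s≤ = cong lift (toℕ-clamp LP s≤)
  level-rung (inj₂ _) s≤ = toℕ-clamp LQ s≤

  label-rung : ∀ π {s} → label (rung π s) ≡ just π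
  label-rung (inj₁ _) = refl
  label-rung (inj₂ _) = refl

  data Kind (v : V) : Set where
    on-rung : ∀ π s → s ≤ top π → v ≡ rung π s → Kind v
    is-a0 : v ≡ a0 → Kind v
    is-b0 : v ≡ b0 → Kind v

  kind : ∀ v → Kind v
  kind (pv i p) = on-rung (inj₁ i) (toℕ p) (toℕ≤ p) (cong (pv i) (sym (clamp-toℕ LP p)))
  kind (qv j q) = on-rung (inj₂ j) (toℕ q) (toℕ≤ q) (cong (qv j) (sym (clamp-toℕ LQ q)))
  kind a0 = is-a0 refl
  kind b0 = is-b0 refl

  botAdj topAdj : Rung → Rung → Bool
  botAdj = splitGraph H
  topAdj = splitGraph (λ i j → not (H i j))

  data RungEdge (π : Rung) (s : ℕ) (π′ : Rung) (t : ℕ) : Set where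
    along : π ≡ π′ → (suc s ≡ t) ⊎ (suc t ≡ s) → RungEdge π s π′ t
    at-bottom : π ≢ π′ → s ≡ 0 → t ≡ 0 → botAdj π π′ ≡ true → RungEdge π s π′ t
    at-top : π ≢ π′ → s ≡ top π → t ≡ top π′ → topAdj π π′ ≡ true → RungEdge π s π′ t

  position-eq : ∀ ρ {x y} → x ≤ top ρ → position (rung ρ x) ≡ y → x ≡ y
  position-eq ρ x≤ e = trans (sym (position-rung ρ x≤)) e

  position-step : ∀ ρ ρ′ {x y} → x ≤ top ρ → y ≤ top ρ′ → suc (position (rung ρ x)) ≡ position (rung ρ′ y) → suc x ≡ y
  position-step ρ ρ′ x≤ y≤ e = trans (cong suc (sym (position-rung ρ x≤))) (trans e (position-rung ρ′ y≤))

  rungEdge : ∀ {π π′ s t} → s ≤ top π → t ≤ top π′ → rung π s ~ rung π′ t → RungEdge π s π′ t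
  rungEdge {inj₁ i} {inj₁ j} s≤ t≤ (inj₁ (e , st)) = along (cong inj₁ e) (inj₁ (position-step (inj₁ i) (inj₁ j) s≤ t≤ st))
  rungEdge {inj₁ i} {inj₁ j} s≤ t≤ (inj₂ (e , ts)) = along (cong inj₁ (sym e)) (inj₂ (position-step (inj₁ j) (inj₁ i) t≤ s≤ ts))
  rungEdge {inj₁ i} {inj₂ j} s≤ t≤ (inj₁ (inj₁ (x , y , h))) =
    at-bottom (λ ()) (position-eq (inj₁ i) s≤ x) (position-eq (inj₂ j) t≤ y) h
  rungEdge {inj₁ i} {inj₂ j} s≤ t≤ (inj₁ (inj₂ (x , y , h))) =
    at-top (λ ()) (position-eq (inj₁ i) s≤ x) (position-eq (inj₂ j) t≤ y) (not-false h)
  rungEdge {inj₁ i} {inj₂ j} s≤ t≤ (inj₂ ())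
  rungEdge {inj₂ j} {inj₁ i} s≤ t≤ (inj₁ ())
  rungEdge {inj₂ j} {inj₁ i} s≤ t≤ (inj₂ (inj₁ (x , y , h))) =
    at-bottom (λ ()) (position-eq (inj₂ j) s≤ y) (position-eq (inj₁ i) t≤ x) h
  rungEdge {inj₂ j} {inj₁ i} s≤ t≤ (inj₂ (inj₂ (x , y , h))) =
    at-top (λ ()) (position-eq (inj₂ j) s≤ y) (position-eq (inj₁ i) t≤ x) (not-false h)
  rungEdge {inj₂ j} {inj₂ j′} s≤ t≤ (inj₁ (inj₁ (e , st))) =
    along (cong inj₂ e) (inj₁ (position-step (inj₂ j) (inj₂ j′) s≤ t≤ st))
  rungEdge {inj₂ j} {inj₂ j′} s≤ t≤ (inj₁ (inj₂ (inj₁ (ne , x , y)))) =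
    at-bottom (λ e → ne (inj₂-injective e)) (position-eq (inj₂ j) s≤ x) (position-eq (inj₂ j′) t≤ y) (distinct-true ne)
  rungEdge {inj₂ j} {inj₂ j′} s≤ t≤ (inj₁ (inj₂ (inj₂ (ne , x , y)))) =
    at-top (λ e → ne (inj₂-injective e)) (position-eq (inj₂ j) s≤ x) (position-eq (inj₂ j′) t≤ y) (distinct-true ne)
  rungEdge {inj₂ j} {inj₂ j′} s≤ t≤ (inj₂ (inj₁ (e , ts))) =
    along (cong inj₂ (sym e)) (inj₂ (position-step (inj₂ j′) (inj₂ j) t≤ s≤ ts))
  rungEdge {inj₂ j} {inj₂ j′} s≤ t≤ (inj₂ (inj₂ (inj₁ (ne , x , y)))) =
    at-bottom (λ e → ne (sym (inj₂-injective e))) (position-eq (inj₂ j) s≤ y) (position-eq (inj₂ j′) t≤ x)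
      (distinct-true (≢-sym ne))
  rungEdge {inj₂ j} {inj₂ j′} s≤ t≤ (inj₂ (inj₂ (inj₂ (ne , x , y)))) =
    at-top (λ e → ne (sym (inj₂-injective e))) (position-eq (inj₂ j) s≤ y) (position-eq (inj₂ j′) t≤ x)
      (distinct-true (≢-sym ne))

  ~-sym : ∀ {u v} → u ~ v → v ~ u
  ~-sym (inj₁ r) = inj₂ r
  ~-sym (inj₂ r) = inj₁ r

  ¬a0~a0 : ¬ (a0 ~ a0)
  ¬a0~a0 (inj₁ ())
  ¬a0~a0 (inj₂ ())

  ¬b0~b0 : ¬ (b0 ~ b0)
  ¬b0~b0 (inj₁ ())
  ¬b0~b0 (inj₂ ())

  ¬b0~a0 : ¬ (b0 ~ a0)
  ¬b0~a0 (inj₁ ())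
  ¬b0~a0 (inj₂ ())

  a0-neighbour-level : ∀ {v} → a0 ~ v → level v ≡ 0
  a0-neighbour-level {pv i p} (inj₁ e) = trans (cong lift e) lift-0
  a0-neighbour-level {pv i p} (inj₂ ())
  a0-neighbour-level {qv j q} (inj₁ e) = e
  a0-neighbour-level {qv j q} (inj₂ ())
  a0-neighbour-level {a0} a = ⊥-elim (¬a0~a0 a)
  a0-neighbour-level {b0} a = ⊥-elim (¬b0~a0 (~-sym {a0} {b0} a))

  b0-neighbour-level : ∀ {v} → b0 ~ v → level v ≡ LQ
  b0-neighbour-level {pv i p} (inj₁ e) = trans (cong lift e) lift-LP
  b0-neighbour-level {pv i p} (inj₂ ())
  b0-neighbour-level {qv j q} (inj₁ e) = e
  b0-neighbour-level {qv j q} (inj₂ ())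
  b0-neighbour-level {a0} a = ⊥-elim (¬b0~a0 a)
  b0-neighbour-level {b0} a = ⊥-elim (¬b0~b0 a)

  simple : SimpleGraph G
  simple = record { ~-sym = λ {u} {v} → ~-sym {u} {v} ; ~-irrefl = λ {u} → irrefl {u} }
    where
    irrefl : ∀ {u} → ¬ (u ~ u)
    irrefl {u} a with kind u
    ... | is-a0 refl = ¬a0~a0 a
    ... | is-b0 refl = ¬b0~b0 a
    ... | on-rung π s s≤ refl with rungEdge s≤ s≤ a
    ...   | along _ (inj₁ e) = 1+n≢n e
    ...   | along _ (inj₂ e) = 1+n≢n e
    ...   | at-bottom ne _ _ _ = ne refl
    ...   | at-top ne _ _ _ = ne refl

  rung-adjacent : ∀ π {s} → s < top π → rung π s ~ rung π (suc s)
  rung-adjacent (inj₁ i) {s} s< = inj₁ (refl , trans (cong suc (position-rung (inj₁ i) (<⇒≤ s<))) (sym (position-rung (inj₁ i) s<)))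
  rung-adjacent (inj₂ j) {s} s< = inj₁ (inj₁ (refl , trans (cong suc (position-rung (inj₂ j) (<⇒≤ s<))) (sym (position-rung (inj₂ j) s<))))

  rung-induced : ∀ π {s t} → s ≤ top π → t ≤ top π → rung π s ~ rung π t → (suc s ≡ t) ⊎ (suc t ≡ s)
  rung-induced π s≤ t≤ a with rungEdge s≤ t≤ a
  ... | along _ r = r
  ... | at-bottom ne _ _ _ = ⊥-elim (ne refl)
  ... | at-top ne _ _ _ = ⊥-elim (ne refl)

  rungs-meet-at-ends : ∀ {π π′ s t} → π ≢ π′ → s ≤ top π → t ≤ top π′ → rung π s ~ rung π′ t →
    (s ≡ 0 × t ≡ 0) ⊎ (s ≡ top π × t ≡ top π′)
  rungs-meet-at-ends ne s≤ t≤ a with rungEdge s≤ t≤ a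
  ... | along e _ = ⊥-elim (ne e)
  ... | at-bottom _ x y _ = inj₁ (x , y)
  ... | at-top _ x y _ = inj₂ (x , y)

  level-bottom : ∀ π → level (rung π 0) ≡ 0
  level-bottom π = trans (level-rung π z≤n) (levelOn-0 π)

  level-top : ∀ π → level (rung π (top π)) ≡ LQ
  level-top π = trans (level-rung π ≤-refl) (levelOn-top π)

  level-mono : ∀ π {p q} → p ≤ q → q ≤ top π → level (rung π p) ≤ level (rung π q)
  level-mono π p≤q q≤ with m≤n⇒m<n∨m≡n p≤q
  ... | inj₂ refl = ≤-refl
  ... | inj₁ p<q = subst₂ _≤_ (sym (level-rung π (≤-trans p≤q q≤))) (sym (level-rung π q≤)) (<⇒≤ (levelOn-strict π p<q))

  rung-step-or-flat : ∀ {u v} → u ~ v → RungStep top rung u v ⊎ RungStep top rung v u ⊎ level u ≡ level v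
  rung-step-or-flat {u} {v} a with kind u | kind v
  ... | is-a0 refl | _ = inj₂ (inj₂ (sym (a0-neighbour-level a)))
  ... | is-b0 refl | _ = inj₂ (inj₂ (sym (b0-neighbour-level a)))
  ... | on-rung π s _ refl | is-a0 refl = inj₂ (inj₂ (a0-neighbour-level (~-sym {rung π s} {a0} a)))
  ... | on-rung π s _ refl | is-b0 refl = inj₂ (inj₂ (b0-neighbour-level (~-sym {rung π s} {b0} a)))
  ... | on-rung π s s≤ refl | on-rung π′ t t≤ refl with rungEdge s≤ t≤ a
  ...   | along refl (inj₁ refl) = inj₁ (π , s , t≤ , refl , refl)
  ...   | along refl (inj₂ refl) = inj₂ (inj₁ (π , t , s≤ , refl , refl))
  ...   | at-bottom _ refl refl _ = inj₂ (inj₂ (trans (level-bottom π) (sym (level-bottom π′))))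
  ...   | at-top _ refl refl _ = inj₂ (inj₂ (trans (level-top π) (sym (level-top π′))))

  ladder : Ladder G
  ladder = record
    { Rung = Rung ; _≟ʳ_ = ≡-dec _≟_ _≟_ ; top = top ; rung = rung ; level = level ; top≥2 = top≥2
    ; rung-position-injective = λ {π} {π′} s≤ t≤ e →
        trans (sym (position-rung π s≤)) (trans (cong position e) (position-rung π′ t≤))
    ; rung-injective = λ {π} {π′} e → just-injective (trans (sym (label-rung π)) (trans (cong label e) (label-rung π′)))
    ; rung-adjacent = rung-adjacent
    ; rung-induced = rung-induced
    ; rungs-meet-at-ends = rungs-meet-at-ends
    ; level-mono = level-mono
    ; rung-step-or-flat = rung-step-or-flat }

  open LadderCuts simple ladder using (LevelConstant)
  open LadderHoles simple ladder

  bottom-sound : ∀ {π π′} → botAdj π π′ ≡ true → rung π 0 ~ rung π′ 0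
  bottom-sound {inj₁ i} {inj₁ i′} ()
  bottom-sound {inj₁ i} {inj₂ j} h = inj₁ (inj₁ (refl , refl , h))
  bottom-sound {inj₂ j} {inj₁ i} h = inj₂ (inj₁ (refl , refl , h))
  bottom-sound {inj₂ j} {inj₂ j′} h = inj₁ (inj₂ (inj₁ (distinct-true-inv h , refl , refl)))

  bottom-complete : ∀ {π π′} → rung π 0 ~ rung π′ 0 → botAdj π π′ ≡ true
  bottom-complete {π} a with rungEdge z≤n z≤n a
  ... | along _ (inj₁ ())
  ... | along _ (inj₂ ())
  ... | at-bottom _ _ _ b = b
  ... | at-top _ x _ _ = ⊥-elim (top≢0 π (sym x))

  top-sound : ∀ {π π′} → topAdj π π′ ≡ true → rung π (top π) ~ rung π′ (top π′)
  top-sound {inj₁ i} {inj₁ i′} ()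
  top-sound {inj₁ i} {inj₂ j} h =
    inj₁ (inj₂ (position-rung (inj₁ i) ≤-refl , position-rung (inj₂ j) ≤-refl , not-true h))
  top-sound {inj₂ j} {inj₁ i} h =
    inj₂ (inj₂ (position-rung (inj₁ i) ≤-refl , position-rung (inj₂ j) ≤-refl , not-true h))
  top-sound {inj₂ j} {inj₂ j′} h =
    inj₁ (inj₂ (inj₂ (distinct-true-inv h , position-rung (inj₂ j) ≤-refl , position-rung (inj₂ j′) ≤-refl)))

  top-complete : ∀ {π π′} → rung π (top π) ~ rung π′ (top π′) → topAdj π π′ ≡ true
  top-complete {π} a with rungEdge ≤-refl ≤-refl a
  ... | along refl (inj₁ s) = ⊥-elim (1+n≢n s)
  ... | along refl (inj₂ s) = ⊥-elim (1+n≢n s)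
  ... | at-bottom _ x _ _ = ⊥-elim (top≢0 π x)
  ... | at-top _ _ _ b = b

  a0-off-rung : ∀ π s → a0 ≢ rung π s
  a0-off-rung (inj₁ _) _ ()
  a0-off-rung (inj₂ _) _ ()

  b0-off-rung : ∀ π s → b0 ≢ rung π s
  b0-off-rung (inj₁ _) _ ()
  b0-off-rung (inj₂ _) _ ()

  a0-attached : ∀ π → Attached a0 π 0
  a0-attached π = record
    { touches = ~-sym {a0} {rung π 0} (touch π)
    ; touches-only = λ {s} s≤ a → levelOn-injective π
        (trans (sym (level-rung π s≤)) (trans (a0-neighbour-level {rung π s} a) (sym (levelOn-0 π))))
    ; off-rung = a0-off-rung π }
    where
    touch : ∀ π → a0 ~ rung π 0
    touch (inj₁ _) = inj₁ refl
    touch (inj₂ _) = inj₁ refl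

  b0-attached : ∀ π → Attached b0 π (top π)
  b0-attached π = record
    { touches = ~-sym {b0} {rung π (top π)} (touch π)
    ; touches-only = λ {s} s≤ a → levelOn-injective π
        (trans (sym (level-rung π s≤)) (trans (b0-neighbour-level {rung π s} a) (sym (levelOn-top π))))
    ; off-rung = b0-off-rung π }
    where
    touch : ∀ π → b0 ~ rung π (top π)
    touch (inj₁ i) = inj₁ (position-rung (inj₁ i) ≤-refl)
    touch (inj₂ j) = inj₁ (position-rung (inj₂ j) ≤-refl)

  level-strict : ∀ π {s} → suc s ≤ top π → level (rung π s) < level (rung π (suc s))
  level-strict π {s} s< = subst₂ _<_ (sym (level-rung π (<⇒≤ s<))) (sym (level-rung π s<)) (levelOn-strict π (n<1+n s))

  flat-edge-at-end : ∀ {u v} → u ~ v → level u ≡ level v → (level u ≡ 0) ⊎ (level u ≡ LQ)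
  flat-edge-at-end {u} {v} a e with kind u | kind v
  ... | is-a0 refl | _ = inj₁ refl
  ... | is-b0 refl | _ = inj₂ refl
  ... | on-rung _ _ _ refl | is-a0 refl = inj₁ e
  ... | on-rung _ _ _ refl | is-b0 refl = inj₂ e
  ... | on-rung π s s≤ refl | on-rung π′ t t≤ refl with rungEdge s≤ t≤ a
  ...   | along refl (inj₁ refl) = ⊥-elim (<⇒≢ (level-strict π t≤) e)
  ...   | along refl (inj₂ refl) = ⊥-elim (<⇒≢ (level-strict π s≤) (sym e))
  ...   | at-bottom _ refl refl _ = inj₁ (level-bottom π)
  ...   | at-top _ refl refl _ = inj₂ (level-top π)

  nothing≢just : ∀ {π : Rung} → nothing ≢ just π
  nothing≢just ()

  labelled-at : ∀ (end : Rung → ℕ) {λ₀} → (∀ π → levelOn π (end π) ≡ λ₀) →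
    ∀ {v π} → level v ≡ λ₀ → label v ≡ just π → v ≡ rung π (end π)
  labelled-at end lvl {v} hv lv with kind v
  ... | is-a0 refl = ⊥-elim (nothing≢just lv)
  ... | is-b0 refl = ⊥-elim (nothing≢just lv)
  ... | on-rung π s s≤ refl with just-injective (trans (sym (label-rung π)) lv)
  ...   | refl = cong (rung π) (levelOn-injective π (trans (sym (level-rung π s≤)) (trans hv (sym (lvl π)))))

  unlabelled-unique : ∀ {u v} → level u ≡ level v → label u ≡ nothing → label v ≡ nothing → u ≡ v
  unlabelled-unique {u} {v} e lu lv with kind u | kind v
  ... | on-rung π _ _ refl | _ = ⊥-elim (nothing≢just (trans (sym lu) (label-rung π)))
  ... | _ | on-rung π _ _ refl = ⊥-elim (nothing≢just (trans (sym lv) (label-rung π)))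
  ... | is-a0 refl | is-a0 refl = refl
  ... | is-b0 refl | is-b0 refl = refl
  ... | is-a0 refl | is-b0 refl = ⊥-elim (LQ≢0 (sym e))
  ... | is-b0 refl | is-a0 refl = ⊥-elim (LQ≢0 e)

  unlabelled-at-bottom : ∀ {u π} → level u ≡ 0 → label u ≡ nothing → u ~ rung π 0
  unlabelled-at-bottom {u} {π} hu lu with kind u
  ... | is-a0 refl = ~-sym {rung π 0} {a0} (Attached.touches (a0-attached π))
  ... | is-b0 refl = ⊥-elim (LQ≢0 hu)
  ... | on-rung ρ _ _ refl = ⊥-elim (nothing≢just (trans (sym lu) (label-rung ρ)))

  unlabelled-at-top : ∀ {u π} → level u ≡ LQ → label u ≡ nothing → u ~ rung π (top π)
  unlabelled-at-top {u} {π} hu lu with kind u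
  ... | is-a0 refl = ⊥-elim (LQ≢0 (sym hu))
  ... | is-b0 refl = ~-sym {rung π (top π)} {b0} (Attached.touches (b0-attached π))
  ... | on-rung ρ _ _ refl = ⊥-elim (nothing≢just (trans (sym lu) (label-rung ρ)))

  noLevelConstantHole : ∀ C → LevelConstant C → ⊥
  noLevelConstantHole C flat
    with flat-edge-at-end {Walk.walk C 0} {Walk.walk C 1} (FirstFour.adj01 C) (flat (Walk.at C 0) (Walk.at C 1))
  ... | inj₁ z = EndCograph.noHoleAtLevel 0 bottom botAdj (split-noP4 half) (split-noC4 half) label
        (labelled-at bottom levelOn-0) (λ hu hv → unlabelled-unique (trans hu (sym hv))) unlabelled-at-bottom
        bottom-sound bottom-complete C (λ t → trans (flat t (Walk.at C 0)) z)
  ... | inj₂ z = EndCograph.noHoleAtLevel LQ top topAdj (split-noP4 (half-complement half))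
        (split-noC4 (half-complement half)) label
        (labelled-at top levelOn-top) (λ hu hv → unlabelled-unique (trans hu (sym hv))) unlabelled-at-top
        top-sound top-complete C (λ t → trans (flat t (Walk.at C 0)) z)

  bottom-link : ∀ {π₁ π₂} (b : Bool) → botAdj π₁ π₂ ≡ b → Link bottom π₁ π₂ (if b then nothing else just a0)
  bottom-link true e = direct (bottom-sound e)
  bottom-link {π₁} {π₂} false e = through (λ a → true≢false (bottom-complete a) e) (a0-attached π₁) (a0-attached π₂)

  top-link : ∀ {π₁ π₂} (b : Bool) → topAdj π₁ π₂ ≡ b → Link top π₁ π₂ (if b then nothing else just b0)
  top-link true e = direct (top-sound e)
  top-link {π₁} {π₂} false e = through (λ a → true≢false (top-complete a) e) (b0-attached π₁) (b0-attached π₂)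

  a0-b0-apart : ∀ bb bt → Apart (if bt then nothing else just b0) (if bb then nothing else just a0)
  a0-b0-apart _ true = tt
  a0-b0-apart true false = tt
  a0-b0-apart false false = ¬b0~a0 , λ ()

  linksAt : ∀ {π₁ π₂} bb → botAdj π₁ π₂ ≡ bb → ∀ bt → topAdj π₁ π₂ ≡ bt → PairLinks π₁ π₂
  linksAt bb eb bt et = record { bottom-link = bottom-link bb eb ; top-link = top-link bt et ; tp-bt-apart = a0-b0-apart bb bt }

  holes : RungPairHoles
  holes = canonicalHoles (λ {π₁} {π₂} _ → linksAt (botAdj π₁ π₂) refl (topAdj π₁ π₂) refl)

  open RungPairHoles holes

  a0∈ : ∀ {π₁ π₂} (ne : π₁ ≢ π₂) → botAdj π₁ π₂ ≡ false → a0 ∈H hole ne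
  a0∈ {π₁} {π₂} ne = at (botAdj π₁ π₂) refl
    where
    at : ∀ bb (eb : botAdj π₁ π₂ ≡ bb) → bb ≡ false → a0 ∈H Canonical.hole ne (linksAt bb eb (topAdj π₁ π₂) refl)
    at bb eb refl = Canonical.bottom∈hole ne (linksAt false eb (topAdj π₁ π₂) refl) refl

  b0∈ : ∀ {π₁ π₂} (ne : π₁ ≢ π₂) → topAdj π₁ π₂ ≡ false → b0 ∈H hole ne
  b0∈ {π₁} {π₂} ne = at (topAdj π₁ π₂) refl
    where
    at : ∀ bt (et : topAdj π₁ π₂ ≡ bt) → bt ≡ false → b0 ∈H Canonical.hole ne (linksAt (botAdj π₁ π₂) refl bt et)
    at bt et refl = Canonical.top∈hole ne (linksAt (botAdj π₁ π₂) refl false et) refl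

  EndApex : V → Set
  EndApex v = (v ≡ a0) ⊎ (v ≡ b0)

  endApex-avoids : ∀ {v} → EndApex v → ∀ π → AvoidsStart π v
  endApex-avoids (inj₁ refl) π _ = a0-off-rung π _
  endApex-avoids (inj₂ refl) π _ = b0-off-rung π _

  -- Two P-rungs are adjacent at neither end.
  endApex∈P-pair : ∀ {v i i′} → EndApex v → (ne : inj₁ i ≢ inj₁ i′) → v ∈H hole ne
  endApex∈P-pair (inj₁ refl) ne = a0∈ ne refl
  endApex∈P-pair (inj₂ refl) ne = b0∈ ne refl

  -- A P-rung and a Q-rung are adjacent at exactly one end.
  endApex-with-P₁ : ∀ {i π} (ne : inj₁ i ≢ π) → Σ V λ v → EndApex v × v ∈H hole ne
  endApex-with-P₁ {π = inj₁ _} ne = a0 , inj₁ refl , a0∈ ne refl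
  endApex-with-P₁ {i} {inj₂ j} ne with bool-cases (H i j)
  ... | inj₁ h = b0 , inj₂ refl , b0∈ ne (cong not h)
  ... | inj₂ h = a0 , inj₁ refl , a0∈ ne h

  endApex-with-P₂ : ∀ {π i} (ne : π ≢ inj₁ i) → Σ V λ v → EndApex v × v ∈H hole ne
  endApex-with-P₂ {inj₁ _} ne = a0 , inj₁ refl , a0∈ ne refl
  endApex-with-P₂ {inj₂ j} {i} ne with bool-cases (H i j)
  ... | inj₁ h = b0 , inj₂ refl , b0∈ ne (cong not h)
  ... | inj₂ h = a0 , inj₁ refl , a0∈ ne h

  hub : Hub holes
  hub = record
    { w = inj₁ i₀ ; w′ = inj₁ i₁ ; w≢w′ = w≢w′
    ; shared-from = λ ne → let (v , ev , v∈) = endApex-with-P₁ ne in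
        v , endApex-avoids ev (inj₁ i₀) , v∈ , endApex∈P-pair ev w≢w′
    ; shared-to = λ ne → let (v , ev , v∈) = endApex-with-P₂ ne in
        v , endApex-avoids ev (inj₁ i₀) , v∈ , endApex∈P-pair ev w≢w′
    ; bridge = bridge }
    where
    i₀ i₁ : Fin n
    i₀ = proj₁ (two-distinct n≥2)
    i₁ = proj₁ (proj₂ (two-distinct n≥2))
    w≢w′ : _≢_ {A = Rung} (inj₁ i₀) (inj₁ i₁)
    w≢w′ e = proj₂ (proj₂ (two-distinct n≥2)) (inj₁-injective e)
    -- a Q-rung has length at least 3, so its fourth vertex is shared as well
    bridge : ∀ {π₁ π₂} (ne : π₁ ≢ π₂) (π₁≢w : π₁ ≢ inj₁ i₀) →
      Σ V λ v → AvoidsStart π₁ v × v ∈H hole ne × v ∈H hole π₁≢w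
    bridge {inj₁ i} ne π₁≢w = let (v , ev , v∈) = endApex-with-P₁ ne in
      v , endApex-avoids ev (inj₁ i) , v∈ , endApex∈P-pair ev π₁≢w
    bridge {inj₂ j} ne π₁≢w = rung (inj₂ j) 3 , avoids , rung₁⊆ ne LQ≥3 , rung₁⊆ π₁≢w LQ≥3
      where
      avoids : AvoidsStart (inj₂ j) (rung (inj₂ j) 3)
      avoids p≤2 e = <⇒≱ (s≤s p≤2) (≤-reflexive (Ladder.rung-position-injective ladder LQ≥3 (≤-trans p≤2 (≤-trans (n≤1+n 2) LQ≥3)) e))

  evenAllHolesEquivalent : AllHolesEquivalent G
  evenAllHolesEquivalent = ladderAllHolesEquivalent holes hub noLevelConstantHole

oddLen≥2 : ∀ {ℓ} → 7 ≤ ℓ → 2 ≤ oddLen ℓ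
oddLen≥2 ℓ≥7 = /-monoˡ-≤ 2 (∸-monoˡ-≤ 3 ℓ≥7)

even⇒≥8 : ∀ {ℓ} → 7 ≤ ℓ → ℓ % 2 ≡ 0 → 8 ≤ ℓ
even⇒≥8 ℓ≥7 e with m≤n⇒m<n∨m≡n ℓ≥7
... | inj₁ ℓ>7 = ℓ>7
... | inj₂ refl with e
... | ()

evenLenP≥2 : ∀ {ℓ} → 8 ≤ ℓ → 2 ≤ evenLenP ℓ
evenLenP≥2 ℓ≥8 = ∸-monoˡ-≤ 2 (/-monoˡ-≤ 2 ℓ≥8)

evenLenQ≡1+evenLenP : ∀ {ℓ} → 8 ≤ ℓ → evenLenQ ℓ ≡ suc (evenLenP ℓ)
evenLenQ≡1+evenLenP {ℓ} ℓ≥8 = half-∸ (ℓ / 2) (/-monoˡ-≤ 2 (≤-trans (s≤s (s≤s (s≤s (s≤s z≤n)))) ℓ≥8))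
  where
  half-∸ : ∀ h → 2 ≤ h → h ∸ 1 ≡ suc (h ∸ 2)
  half-∸ (suc (suc _)) _ = refl
  half-∸ (suc zero) (s≤s ())

mainTheorem13 : (ℓ : ℕ) → 7 ≤ ℓ →
    ((ℓ % 2 ≡ 1) → (F : OddFrame ℓ) → AllHolesEquivalent (oddApexedGraph F))
    × ((ℓ % 2 ≡ 0) → (F : EvenFrame ℓ) → AllHolesEquivalent (evenApexedGraph F))
mainTheorem13 ℓ ℓ≥7 =
    (λ _ F → OddFrameHoles.oddAllHolesEquivalent F (oddLen≥2 ℓ≥7))
  , (λ even F → EvenFrameHoles.evenAllHolesEquivalent F (evenLenP≥2 (even⇒≥8 ℓ≥7 even))
                                                        (evenLenQ≡1+evenLenP (even⇒≥8 ℓ≥7 even)))
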